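{- Let $N$ be a positive integer and suppose $N = x \varphi^m / \sqrt{5}$ for some $x \in \mathcal{F}$ and some integer $m \geq 2$. Then the Zeckendorf representation of $N$ is \[ N = \sum_{i=1}^{m-1} \delta_{m-i}(x) F_i . \] Moreover, $\delta_m(x) = 0$.
   Context: $\varphi=(1+\sqrt5)/2$, $(F_n)_{n\ge1}$ is the Fibonacci sequence ($F_1=F_2=1$, $F_n=F_{n-1}+F_{n-2}$), and $\mathcal{F} := \mathbb{Q}(\varphi)\cap[0,1)$. $\mathfrak{D}$ is the set of sequences $(d_i)_{i\ge1}$ with values in $\{0,1\}$ having no two consecutive terms equal to $1$ and not ultimately equal to $0,1,0,1,\dots$. For $x\in[0,1)$, $\bm\delta(x)=(\delta_i(x))_{i\ge1}$ denotes the unique sequence in $\mathfrak{D}$ with $x=\sum_{i\ge1}\delta_i(x)\varphi^{ -i}$ (the base-$\varphi$ expansion of $x$). The Zeckendorf representation of a positive integer is its expression as $\sum_i d_iF_i$ with $d_i\in\{0,1\}$ and $d_id_{i+1}=0$ for all $i$. -}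

module Defs where

open import Data.Bool using (Bool; true; false; if_then_else_; _∧_)
open import Data.Nat as ℕ using (ℕ; zero; suc; _∸_)
open import Data.Integer as ℤ using (ℤ; +_)
open import Data.Rational as ℚ using (ℚ; 0ℚ; 1ℚ)
open import Data.Product using (Σ; _×_; ∃; ∃-syntax)
open import Data.Sum using (_⊎_)
open import Relation.Binary.PropositionalEquality using (_≡_; _≢_)
open import Relation.Nullary using (¬_)

-- The field ℚ(φ): an element  a + b φ  with a b : ℚ  (φ² = φ + 1).
-- Since {1, φ} is a ℚ-basis, equality of elements is equality of pairs.

record Qφ : Set where
  constructor _⊕_φ
  field
    re : ℚ
    im : ℚ
open Qφ public

infixl 6 _+φ_ _-φ_
infixl 7 _*φ_

_+φ_ : Qφ → Qφ → Qφ
(a ⊕ b φ) +φ (c ⊕ d φ) = (a ℚ.+ c) ⊕ (b ℚ.+ d) φ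

-φ_ : Qφ → Qφ
-φ (a ⊕ b φ) = (ℚ.- a) ⊕ (ℚ.- b) φ

_-φ_ : Qφ → Qφ → Qφ
x -φ y = x +φ (-φ y)

_*φ_ : Qφ → Qφ → Qφ
(a ⊕ b φ) *φ (c ⊕ d φ) =
  ((a ℚ.* c) ℚ.+ (b ℚ.* d)) ⊕ ((a ℚ.* d) ℚ.+ (b ℚ.* c) ℚ.+ (b ℚ.* d)) φ

ofℚ : ℚ → Qφ
ofℚ q = q ⊕ 0ℚ φ

ofℕ : ℕ → Qφ
ofℕ n = ofℚ (+ n ℚ./ 1)

0φ 1φ φ̂ φ⁻¹ √5 : Qφ
0φ  = ofℚ 0ℚ
1φ  = ofℚ 1ℚ
φ̂   = 0ℚ ⊕ 1ℚ φ
φ⁻¹ = (ℚ.- 1ℚ) ⊕ 1ℚ φ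
√5  = (ℚ.- 1ℚ) ⊕ (+ 2 ℚ./ 1) φ

φ^ : ℕ → Qφ
φ^ zero    = 1φ
φ^ (suc n) = φ^ n *φ φ̂

φ^- : ℕ → Qφ
φ^- zero    = 1φ
φ^- (suc n) = φ^- n *φ φ⁻¹

-- Order on ℚ(φ), induced by the real embedding φ = (1+√5)/2.
-- a + bφ = (p + q√5)/2 with p = 2a + b, q = b; p + q√5 ≥ 0 iff
--   (p ≥ 0 and q ≥ 0) or (q ≥ 0, p < 0, p² ≤ 5q²) or (q < 0, p ≥ 0, 5q² ≤ p²).

NonNegφ : Qφ → Set
NonNegφ (a ⊕ b φ) =
  (0ℚ ℚ.≤ p × 0ℚ ℚ.≤ q)
  ⊎ ((0ℚ ℚ.≤ q × p ℚ.< 0ℚ) × (p ℚ.* p) ℚ.≤ (five ℚ.* (q ℚ.* q)))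
  ⊎ ((q ℚ.< 0ℚ × 0ℚ ℚ.≤ p) × (five ℚ.* (q ℚ.* q)) ℚ.≤ (p ℚ.* p))
  where
  p = (a ℚ.+ a) ℚ.+ b
  q = b
  five = + 5 ℚ./ 1

infix 4 _≤φ_ _<φ_
_≤φ_ : Qφ → Qφ → Set
x ≤φ y = NonNegφ (y -φ x)

_<φ_ : Qφ → Qφ → Set
x <φ y = x ≤φ y × x ≢ y

In𝓕 : Qφ → Set
In𝓕 x = 0φ ≤φ x × x <φ 1φ

-- Digit sequences (d_i)_{i ≥ 1}: modelled as ℕ → Bool, the value at 0
-- is irrelevant (never used).

bit : Bool → ℕ
bit true  = 1
bit false = 0

In𝔇 : (ℕ → Bool) → Set
In𝔇 d =
  (∀ i → 1 ℕ.≤ i → d i ∧ d (suc i) ≡ false)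
  × ¬ (∃[ n ] (1 ℕ.≤ n × (∀ k → d (n ℕ.+ 2 ℕ.* k) ≡ false × d (suc (n ℕ.+ 2 ℕ.* k)) ≡ true)))

partialφ : (ℕ → Bool) → ℕ → Qφ
partialφ d zero    = 0φ
partialφ d (suc n) = partialφ d n +φ (if d (suc n) then φ^- (suc n) else 0φ)

-- x = ∑_{i≥1} d_i φ^{-i}: the (nondecreasing) partial sums converge to x,
-- i.e. they are all ≤ x and x - S_n eventually drops below every
-- positive rational ε.
IsExpansion : (ℕ → Bool) → Qφ → Set
IsExpansion d x =
  (∀ n → partialφ d n ≤φ x)
  × (∀ (ε : ℚ) → 0ℚ ℚ.< ε → ∃[ n ] (x -φ partialφ d n <φ ofℚ ε))

-- Fibonacci numbers, F 1 = F 2 = 1 (F 0 = 0 is never used below).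

fib : ℕ → ℕ
fib zero          = 0
fib (suc zero)    = 1
fib (suc (suc n)) = fib (suc n) ℕ.+ fib n

sum1 : (ℕ → ℕ) → ℕ → ℕ
sum1 f zero    = 0
sum1 f (suc n) = sum1 f n ℕ.+ f (suc n)

IsZeckendorfRep : ℕ → ℕ → (ℕ → Bool) → Set
IsZeckendorfRep N n e =
  N ≡ sum1 (λ i → bit (e i) ℕ.* fib i) n
  × (∀ i → 1 ℕ.≤ i → suc i ℕ.≤ n → e i ∧ e (suc i) ≡ false)

-- Write G = Σ_{i≤m} δ_i φ^(m-i) = a + bφ with a, b ∈ ℕ.  The recursion G ↦ Gφ + δ and
-- φ² = φ + 1 make b the Fibonacci sum Σ_{i<m} δ_{m-i} F_i, and the conjugate C = a + bψ,
-- ψ = 1 - φ, satisfies G - C = b√5.  As no two consecutive digits are 1, g = xφ^m - G lies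
-- in [0, 1], and in [0, φ⁻¹] when δ_m = 1; the recursion C ↦ ψC + δ keeps C in
-- [μ - 1, φ⁻¹ - μ] when δ_m = 0 and in [φ⁻¹, φ - μ] when δ_m = 1, where μ = φ^-(m+1).
-- So (N - b)√5 = g + C lies strictly between -1 and √5, whence N = b, and then g + C = 0
-- rules out δ_m = 1.
--
-- The order of ℚ(φ) = ℚ(√5) is defined by signs and squares of rationals.  What is used of
-- it: nonnegativity is preserved by sums and by multiplication with φ and φ⁻¹, and every
-- positive element exceeds a positive rational, which turns the limit x = Σ δ_i φ^-i into
-- an inequality.
module Submission where

open import Algebra.Bundles using (CommutativeRing)
open import Algebra.Structures using (IsCommutativeRing)
open import Data.Bool using (Bool; true; false; _∧_; if_then_else_)
import Data.Bool.Properties as Bool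
open import Data.Empty using (⊥; ⊥-elim)
open import Data.Integer using (+_)
import Data.Integer.Properties as ℤ
open import Data.Maybe using (Maybe; just; nothing)
open import Data.Nat as ℕ using (ℕ; zero; suc; _∸_; s≤s; z≤n)
import Data.Nat.Coprimality as Coprime
import Data.Nat.Properties as ℕ
open import Data.Nat.Tactic.RingSolver renaming (solve-∀ to solve-∀ℕ)
open import Data.Product using (_×_; _,_; proj₁; proj₂; ∃-syntax)
open import Data.Rational
  using (ℚ; mkℚ; 0ℚ; 1ℚ; ½; _+_; _*_; -_; _-_; _/_; _<_; NonZero; 1/_; nonNegative; positive)
import Data.Rational.Properties as ℚ
open import Data.Sum using (_⊎_; inj₁; inj₂)
open import Function using (_∘_)
open import Level using (0ℓ)
open import Relation.Binary.Definitions using (DecidableEquality; Decidable; Tri; tri<; tri≈; tri>)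
open import Relation.Binary.PropositionalEquality
open import Relation.Binary.Structures using (IsPreorder)
open import Relation.Nullary using (¬_; Dec; yes; no)
open import Relation.Nullary.Decidable using (map′; _×-dec_; _⊎-dec_; from-yes; from-no)
open import Tactic.RingSolver using (solve-∀)
open import Tactic.RingSolver.Core.AlmostCommutativeRing using (AlmostCommutativeRing; fromCommutativeRing)

open import Defs

-- ℚ(φ) as a commutative ring

-- With an exact zero test the solver's normal forms are canonical, so that it proves
-- identities between closed constants of ℚ(φ) such as φ φ⁻¹ = 1.
zeroTest : {A : Set} → DecidableEquality A → (z x : A) → Maybe (z ≡ x)
zeroTest _≟_ z x with z ≟ x
... | yes z≡x = just z≡x
... | no _    = nothing

ℚ-ring : AlmostCommutativeRing 0ℓ 0ℓ
ℚ-ring = fromCommutativeRing ℚ.+-*-commutativeRing (zeroTest ℚ._≟_ 0ℚ)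

⊕-cong : ∀ {a b c d} → a ≡ c → b ≡ d → a ⊕ b φ ≡ c ⊕ d φ
⊕-cong refl refl = refl

_≟φ_ : DecidableEquality Qφ
(a ⊕ b φ) ≟φ (c ⊕ d φ) =
  map′ (λ (a≡c , b≡d) → ⊕-cong a≡c b≡d) (λ e → cong re e , cong im e) ((a ℚ.≟ c) ×-dec (b ℚ.≟ d))

+φ-*φ-isCommutativeRing : IsCommutativeRing _≡_ _+φ_ _*φ_ (λ z → -φ z) 0φ 1φ
+φ-*φ-isCommutativeRing = record
  { isRing = record
    { +-isAbelianGroup = record
      { isGroup = record
        { isMonoid = record
          { isSemigroup = record
            { isMagma = record { isEquivalence = isEquivalence ; ∙-cong = cong₂ _+φ_ }
            ; assoc = λ { (a ⊕ b φ) (c ⊕ d φ) (e ⊕ f φ) → ⊕-cong (ℚ.+-assoc a c e) (ℚ.+-assoc b d f) } }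
          ; identity = (λ { (a ⊕ b φ) → ⊕-cong (ℚ.+-identityˡ a) (ℚ.+-identityˡ b) })
                     , (λ { (a ⊕ b φ) → ⊕-cong (ℚ.+-identityʳ a) (ℚ.+-identityʳ b) }) }
        ; inverse = (λ { (a ⊕ b φ) → ⊕-cong (ℚ.+-inverseˡ a) (ℚ.+-inverseˡ b) })
                  , (λ { (a ⊕ b φ) → ⊕-cong (ℚ.+-inverseʳ a) (ℚ.+-inverseʳ b) })
        ; ⁻¹-cong = cong (λ z → -φ z) }
      ; comm = λ { (a ⊕ b φ) (c ⊕ d φ) → ⊕-cong (ℚ.+-comm a c) (ℚ.+-comm b d) } }
    ; *-cong = cong₂ _*φ_
    ; *-assoc = λ { (a ⊕ b φ) (c ⊕ d φ) (e ⊕ f φ) → ⊕-cong (assoc-re a b c d e f) (assoc-im a b c d e f) }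
    ; *-identity = (λ { (a ⊕ b φ) → ⊕-cong (identityˡ-re a b) (identityˡ-im a b) })
                 , (λ { (a ⊕ b φ) → ⊕-cong (identityʳ-re a b) (identityʳ-im a b) })
    ; distrib = (λ { (a ⊕ b φ) (c ⊕ d φ) (e ⊕ f φ) →
                       ⊕-cong (distribˡ-re a b c d e f) (distribˡ-im a b c d e f) })
              , (λ { (a ⊕ b φ) (c ⊕ d φ) (e ⊕ f φ) →
                       ⊕-cong (distribʳ-re a b c d e f) (distribʳ-im a b c d e f) }) }
  ; *-comm = λ { (a ⊕ b φ) (c ⊕ d φ) → ⊕-cong (comm-re a b c d) (comm-im a b c d) } }
  where
  assoc-re : ∀ a b c d e f → (a * c + b * d) * e + (a * d + b * c + b * d) * f
                            ≡ a * (c * e + d * f) + b * (c * f + d * e + d * f)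
  assoc-re = solve-∀ ℚ-ring
  assoc-im : ∀ a b c d e f → (a * c + b * d) * f + (a * d + b * c + b * d) * e + (a * d + b * c + b * d) * f
                            ≡ a * (c * f + d * e + d * f) + b * (c * e + d * f) + b * (c * f + d * e + d * f)
  assoc-im = solve-∀ ℚ-ring
  identityˡ-re : ∀ a b → 1ℚ * a + 0ℚ * b ≡ a
  identityˡ-re = solve-∀ ℚ-ring
  identityˡ-im : ∀ a b → 1ℚ * b + 0ℚ * a + 0ℚ * b ≡ b
  identityˡ-im = solve-∀ ℚ-ring
  identityʳ-re : ∀ a b → a * 1ℚ + b * 0ℚ ≡ a
  identityʳ-re = solve-∀ ℚ-ring
  identityʳ-im : ∀ a b → a * 0ℚ + b * 1ℚ + b * 0ℚ ≡ b
  identityʳ-im = solve-∀ ℚ-ring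
  distribˡ-re : ∀ a b c d e f → a * (c + e) + b * (d + f) ≡ (a * c + b * d) + (a * e + b * f)
  distribˡ-re = solve-∀ ℚ-ring
  distribˡ-im : ∀ a b c d e f → a * (d + f) + b * (c + e) + b * (d + f)
                               ≡ (a * d + b * c + b * d) + (a * f + b * e + b * f)
  distribˡ-im = solve-∀ ℚ-ring
  distribʳ-re : ∀ a b c d e f → (c + e) * a + (d + f) * b ≡ (c * a + d * b) + (e * a + f * b)
  distribʳ-re = solve-∀ ℚ-ring
  distribʳ-im : ∀ a b c d e f → (c + e) * b + (d + f) * a + (d + f) * b
                               ≡ (c * b + d * a + d * b) + (e * b + f * a + f * b)
  distribʳ-im = solve-∀ ℚ-ring
  comm-re : ∀ a b c d → a * c + b * d ≡ c * a + d * b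
  comm-re = solve-∀ ℚ-ring
  comm-im : ∀ a b c d → a * d + b * c + b * d ≡ c * b + d * a + d * b
  comm-im = solve-∀ ℚ-ring

+φ-*φ-commutativeRing : CommutativeRing 0ℓ 0ℓ
+φ-*φ-commutativeRing = record { isCommutativeRing = +φ-*φ-isCommutativeRing }

Qφ-ring : AlmostCommutativeRing 0ℓ 0ℓ
Qφ-ring = fromCommutativeRing +φ-*φ-commutativeRing (zeroTest _≟φ_ 0φ)

-- Rational inequalities and the order of ℚ(√5)

-- Rational _≤_ is in scope only in this block: lemma3p2 is stated with ℕ's _≤_.
module _ where
  open import Data.Rational using (_≤_)
  open ℚ.≤-Reasoning

  five : ℚ
  five = + 5 / 1

  neg-square : ∀ a → - a * - a ≡ a * a
  neg-square = solve-∀ ℚ-ring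

  neg-neg : ∀ a → - - a ≡ a
  neg-neg = solve-∀ ℚ-ring

  0≤-a : ∀ {a} → a ≤ 0ℚ → 0ℚ ≤ - a
  0≤-a = ℚ.neg-antimono-≤

  0<-a : ∀ {a} → a < 0ℚ → 0ℚ < - a
  0<-a = ℚ.neg-antimono-<

  0<-a⇒a<0 : ∀ {a} → 0ℚ < - a → a < 0ℚ
  0<-a⇒a<0 {a} 0<-a = subst (_< 0ℚ) (neg-neg a) (ℚ.neg-antimono-< 0<-a)

  -a≤0⇒0≤a : ∀ {a} → - a ≤ 0ℚ → 0ℚ ≤ a
  -a≤0⇒0≤a {a} -a≤0 = subst (0ℚ ≤_) (neg-neg a) (ℚ.neg-antimono-≤ -a≤0)

  ≤-<-absurd : ∀ {a b} → a ≤ b → b < a → ⊥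
  ≤-<-absurd a≤b b<a = ℚ.<-irrefl refl (ℚ.≤-<-trans a≤b b<a)

  p≤q+p : ∀ {p q} → 0ℚ ≤ q → p ≤ q + p
  p≤q+p {p} {q} 0≤q = subst (_≤ q + p) (ℚ.+-identityˡ p) (ℚ.+-monoˡ-≤ p 0≤q)

  p≤p+q : ∀ {p q} → 0ℚ ≤ q → p ≤ p + q
  p≤p+q {p} {q} 0≤q = subst (p ≤_) (ℚ.+-comm q p) (p≤q+p 0≤q)

  p+q<0⇒p<-q : ∀ {p q} → p + q < 0ℚ → p < - q
  p+q<0⇒p<-q {p} {q} p+q<0 = subst₂ _<_ (add-sub p q) (ℚ.+-identityˡ (- q)) (ℚ.+-monoˡ-< (- q) p+q<0)
    where add-sub : ∀ p q → (p + q) + - q ≡ p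
          add-sub = solve-∀ ℚ-ring

  a-b<0⇒a<b : ∀ {a b} → a - b < 0ℚ → a < b
  a-b<0⇒a<b {a} {b} a-b<0 = subst (a <_) (neg-neg b) (p+q<0⇒p<-q a-b<0)

  0≤-⇒≤ : ∀ {a b} → 0ℚ ≤ b - a → a ≤ b
  0≤-⇒≤ {a} {b} 0≤b-a = subst₂ _≤_ (ℚ.+-identityˡ a) (sub-add a b) (ℚ.+-monoˡ-≤ a 0≤b-a)
    where sub-add : ∀ a b → (b - a) + a ≡ b
          sub-add = solve-∀ ℚ-ring

  ≤⇒0≤- : ∀ {a b} → a ≤ b → 0ℚ ≤ b - a
  ≤⇒0≤- {a} {b} a≤b = subst (_≤ b - a) (ℚ.+-inverseʳ a) (ℚ.+-monoˡ-≤ (- a) a≤b)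

  <⇒0<- : ∀ {a b} → a < b → 0ℚ < b - a
  <⇒0<- {a} {b} a<b = subst (_< b - a) (ℚ.+-inverseʳ a) (ℚ.+-monoˡ-< (- a) a<b)

  -a≤b⇒0≤a+b : ∀ {a b} → - a ≤ b → 0ℚ ≤ a + b
  -a≤b⇒0≤a+b {a} {b} -a≤b = subst (0ℚ ≤_) (sub-neg a b) (≤⇒0≤- -a≤b)
    where sub-neg : ∀ a b → b - - a ≡ a + b
          sub-neg = solve-∀ ℚ-ring

  cancel-≤ : ∀ {a b c d} → a + b ≡ c + d → b ≤ d → c ≤ a
  cancel-≤ {a} {b} {c} {d} a+b≡c+d b≤d = begin
    c              ≡⟨ add-sub c d ⟨
    (c + d) + - d  ≡⟨ cong (_+ - d) a+b≡c+d ⟨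
    (a + b) + - d  ≤⟨ ℚ.+-monoʳ-≤ (a + b) (ℚ.neg-antimono-≤ b≤d) ⟩
    (a + b) + - b  ≡⟨ add-sub a b ⟩
    a              ∎
    where add-sub : ∀ a b → (a + b) + - b ≡ a
          add-sub = solve-∀ ℚ-ring

  *-mono-≤-nonNeg : ∀ {a b c d} → 0ℚ ≤ a → a ≤ b → 0ℚ ≤ c → c ≤ d → a * c ≤ b * d
  *-mono-≤-nonNeg {a} {b} {c} {d} 0≤a a≤b 0≤c c≤d = begin
    a * c ≤⟨ ℚ.*-monoˡ-≤-nonNeg a {{nonNegative 0≤a}} c≤d ⟩
    a * d ≤⟨ ℚ.*-monoʳ-≤-nonNeg d {{nonNegative (ℚ.≤-trans 0≤c c≤d)}} a≤b ⟩
    b * d ∎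

  *-cancelʳ-nonNeg : ∀ {r d} → 0ℚ < d → 0ℚ ≤ r * d → 0ℚ ≤ r
  *-cancelʳ-nonNeg {r} {d} 0<d 0≤rd =
    ℚ.*-cancelʳ-≤-pos d {{positive 0<d}} (subst (_≤ r * d) (sym (ℚ.*-zeroˡ d)) 0≤rd)

  *-cancelʳ-square-≤ : ∀ {a b d} → 0ℚ < d → a * (d * d) ≤ b * (d * d) → a ≤ b
  *-cancelʳ-square-≤ {d = d} 0<d =
    ℚ.*-cancelʳ-≤-pos (d * d) {{ℚ.pos*pos⇒pos d {{positive 0<d}} d {{positive 0<d}}}}

  ½*-nonNeg : ∀ {a} → 0ℚ ≤ a → 0ℚ ≤ ½ * a
  ½*-nonNeg = ℚ.*-monoˡ-≤-nonNeg ½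

  ½*-neg : ∀ {a} → a < 0ℚ → ½ * a < 0ℚ
  ½*-neg = ℚ.*-monoʳ-<-pos ½

  ½*-neg⇒neg : ∀ {a} → ½ * a < 0ℚ → a < 0ℚ
  ½*-neg⇒neg {a} ½a<0 with 0ℚ ℚ.≤? a
  ... | yes 0≤a = ⊥-elim (≤-<-absurd (½*-nonNeg 0≤a) ½a<0)
  ... | no  0≰a = ℚ.≰⇒> 0≰a

  five*-mono-≤ : ∀ {a b} → a ≤ b → five * a ≤ five * b
  five*-mono-≤ = ℚ.*-monoˡ-≤-nonNeg five

  ≤-five* : ∀ {a} → 0ℚ ≤ a → a ≤ five * a
  ≤-five* {a} 0≤a = subst (_≤ five * a) (ℚ.*-identityˡ a)
    (ℚ.*-monoʳ-≤-nonNeg a {{nonNegative 0≤a}} (from-yes (1ℚ ℚ.≤? five)))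

  square-nonNeg : ∀ a → 0ℚ ≤ a * a
  square-nonNeg a with ℚ.≤-total 0ℚ a
  ... | inj₁ 0≤a = *-mono-≤-nonNeg ℚ.≤-refl 0≤a ℚ.≤-refl 0≤a
  ... | inj₂ a≤0 =
    subst (0ℚ ≤_) (neg-square a) (*-mono-≤-nonNeg ℚ.≤-refl (0≤-a a≤0) ℚ.≤-refl (0≤-a a≤0))

  five*square-nonNeg : ∀ a → 0ℚ ≤ five * (a * a)
  five*square-nonNeg a = five*-mono-≤ (square-nonNeg a)

  square≤five*square : ∀ a → a * a ≤ five * (a * a)
  square≤five*square a = ≤-five* (square-nonNeg a)

  five*square≤square-five* : ∀ a → five * (a * a) ≤ five * a * (five * a)
  five*square≤square-five* a = begin
    five * (a * a)           ≤⟨ ≤-five* (five*square-nonNeg a) ⟩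
    five * (five * (a * a))  ≡⟨ regroup a ⟩
    five * a * (five * a)    ∎
    where regroup : ∀ a → five * (five * (a * a)) ≡ five * a * (five * a)
          regroup = solve-∀ ℚ-ring

  square-mono-≤ : ∀ {a b} → 0ℚ ≤ a → a ≤ b → a * a ≤ b * b
  square-mono-≤ 0≤a a≤b = *-mono-≤-nonNeg 0≤a a≤b 0≤a a≤b

  square-mono-< : ∀ {a b} → 0ℚ ≤ a → a < b → a * a < b * b
  square-mono-< {a} {b} 0≤a a<b = begin-strict
    a * a ≤⟨ ℚ.*-monoˡ-≤-nonNeg a {{nonNegative 0≤a}} (ℚ.<⇒≤ a<b) ⟩
    a * b <⟨ ℚ.*-monoˡ-<-pos b {{positive (ℚ.≤-<-trans 0≤a a<b)}} a<b ⟩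
    b * b ∎

  square-antimono-≤ : ∀ {a b} → b ≤ a → a ≤ 0ℚ → a * a ≤ b * b
  square-antimono-≤ {a} {b} b≤a a≤0 = begin
    a * a      ≡⟨ neg-square a ⟨
    - a * - a  ≤⟨ square-mono-≤ (0≤-a a≤0) (ℚ.neg-antimono-≤ b≤a) ⟩
    - b * - b  ≡⟨ neg-square b ⟩
    b * b      ∎

  square-antimono-< : ∀ {a b} → b < a → a ≤ 0ℚ → a * a < b * b
  square-antimono-< {a} {b} b<a a≤0 = begin-strict
    a * a      ≡⟨ neg-square a ⟨
    - a * - a  <⟨ square-mono-< (0≤-a a≤0) (ℚ.neg-antimono-< b<a) ⟩
    - b * - b  ≡⟨ neg-square b ⟩
    b * b      ∎

  square-cancel-≤ : ∀ {a b} → 0ℚ ≤ b → a * a ≤ b * b → a ≤ b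
  square-cancel-≤ {a} {b} 0≤b a²≤b² with a ℚ.≤? b
  ... | yes a≤b = a≤b
  ... | no  a≰b = ⊥-elim (≤-<-absurd a²≤b² (square-mono-< 0≤b (ℚ.≰⇒> a≰b)))

  -- The pairs (p, q) with p ≥ |q|√5 ("rational part dominant") and those with q√5 ≥ |p|
  -- ("surd dominant"), written with squares.

  square-+ : ∀ a b → (a + b) * (a + b) ≡ (a * a + b * b) + (a * b + a * b)
  square-+ = solve-∀ ℚ-ring

  five*square-+ : ∀ a b → five * ((a + b) * (a + b))
                        ≡ (five * (a * a) + five * (b * b)) + (five * (a * b) + five * (a * b))
  five*square-+ = solve-∀ ℚ-ring

  square-* : ∀ a b → (a * b) * (a * b) ≡ (a * a) * (b * b)
  square-* = solve-∀ ℚ-ring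

  five*square-* : ∀ a b → (five * (a * b)) * (five * (a * b)) ≡ (five * (a * a)) * (five * (b * b))
  five*square-* = solve-∀ ℚ-ring

  module _ {p₁ q₁ p₂ q₂ : ℚ} where

    ratDominant-cross : 0ℚ ≤ p₁ → 0ℚ ≤ p₂ →
      five * (q₁ * q₁) ≤ p₁ * p₁ → five * (q₂ * q₂) ≤ p₂ * p₂ → five * (q₁ * q₂) ≤ p₁ * p₂
    ratDominant-cross 0≤p₁ 0≤p₂ h₁ h₂ =
      square-cancel-≤ (*-mono-≤-nonNeg ℚ.≤-refl 0≤p₁ ℚ.≤-refl 0≤p₂) (begin
        (five * (q₁ * q₂)) * (five * (q₁ * q₂)) ≡⟨ five*square-* q₁ q₂ ⟩
        (five * (q₁ * q₁)) * (five * (q₂ * q₂))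
          ≤⟨ *-mono-≤-nonNeg (five*square-nonNeg q₁) h₁ (five*square-nonNeg q₂) h₂ ⟩
        (p₁ * p₁) * (p₂ * p₂)                   ≡⟨ square-* p₁ p₂ ⟨
        (p₁ * p₂) * (p₁ * p₂)                   ∎)

    surdDominant-cross : 0ℚ ≤ q₁ → 0ℚ ≤ q₂ →
      p₁ * p₁ ≤ five * (q₁ * q₁) → p₂ * p₂ ≤ five * (q₂ * q₂) → p₁ * p₂ ≤ five * (q₁ * q₂)
    surdDominant-cross 0≤q₁ 0≤q₂ h₁ h₂ =
      square-cancel-≤ (five*-mono-≤ (*-mono-≤-nonNeg ℚ.≤-refl 0≤q₁ ℚ.≤-refl 0≤q₂)) (begin
        (p₁ * p₂) * (p₁ * p₂)                   ≡⟨ square-* p₁ p₂ ⟩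
        (p₁ * p₁) * (p₂ * p₂)
          ≤⟨ *-mono-≤-nonNeg (square-nonNeg p₁) h₁ (square-nonNeg p₂) h₂ ⟩
        (five * (q₁ * q₁)) * (five * (q₂ * q₂)) ≡⟨ five*square-* q₁ q₂ ⟨
        (five * (q₁ * q₂)) * (five * (q₁ * q₂)) ∎)

    ratDominant-+ : 0ℚ ≤ p₁ → 0ℚ ≤ p₂ →
      five * (q₁ * q₁) ≤ p₁ * p₁ → five * (q₂ * q₂) ≤ p₂ * p₂ →
      five * ((q₁ + q₂) * (q₁ + q₂)) ≤ (p₁ + p₂) * (p₁ + p₂)
    ratDominant-+ 0≤p₁ 0≤p₂ h₁ h₂ = begin
      five * ((q₁ + q₂) * (q₁ + q₂))
        ≡⟨ five*square-+ q₁ q₂ ⟩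
      (five * (q₁ * q₁) + five * (q₂ * q₂)) + (five * (q₁ * q₂) + five * (q₁ * q₂))
        ≤⟨ ℚ.+-mono-≤ (ℚ.+-mono-≤ h₁ h₂) (ℚ.+-mono-≤ cross cross) ⟩
      (p₁ * p₁ + p₂ * p₂) + (p₁ * p₂ + p₁ * p₂)
        ≡⟨ square-+ p₁ p₂ ⟨
      (p₁ + p₂) * (p₁ + p₂)
        ∎
      where cross = ratDominant-cross 0≤p₁ 0≤p₂ h₁ h₂

    ratDominant-+-< : 0ℚ ≤ p₁ → 0ℚ ≤ p₂ →
      five * (q₁ * q₁) < p₁ * p₁ → five * (q₂ * q₂) ≤ p₂ * p₂ →
      five * ((q₁ + q₂) * (q₁ + q₂)) < (p₁ + p₂) * (p₁ + p₂)
    ratDominant-+-< 0≤p₁ 0≤p₂ h₁ h₂ = begin-strict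
      five * ((q₁ + q₂) * (q₁ + q₂))
        ≡⟨ five*square-+ q₁ q₂ ⟩
      (five * (q₁ * q₁) + five * (q₂ * q₂)) + (five * (q₁ * q₂) + five * (q₁ * q₂))
        <⟨ ℚ.+-mono-<-≤ (ℚ.+-mono-<-≤ h₁ h₂) (ℚ.+-mono-≤ cross cross) ⟩
      (p₁ * p₁ + p₂ * p₂) + (p₁ * p₂ + p₁ * p₂)
        ≡⟨ square-+ p₁ p₂ ⟨
      (p₁ + p₂) * (p₁ + p₂)
        ∎
      where cross = ratDominant-cross 0≤p₁ 0≤p₂ (ℚ.<⇒≤ h₁) h₂

    surdDominant-+ : 0ℚ ≤ q₁ → 0ℚ ≤ q₂ →
      p₁ * p₁ ≤ five * (q₁ * q₁) → p₂ * p₂ ≤ five * (q₂ * q₂) →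
      (p₁ + p₂) * (p₁ + p₂) ≤ five * ((q₁ + q₂) * (q₁ + q₂))
    surdDominant-+ 0≤q₁ 0≤q₂ h₁ h₂ = begin
      (p₁ + p₂) * (p₁ + p₂)
        ≡⟨ square-+ p₁ p₂ ⟩
      (p₁ * p₁ + p₂ * p₂) + (p₁ * p₂ + p₁ * p₂)
        ≤⟨ ℚ.+-mono-≤ (ℚ.+-mono-≤ h₁ h₂) (ℚ.+-mono-≤ cross cross) ⟩
      (five * (q₁ * q₁) + five * (q₂ * q₂)) + (five * (q₁ * q₂) + five * (q₁ * q₂))
        ≡⟨ five*square-+ q₁ q₂ ⟨
      five * ((q₁ + q₂) * (q₁ + q₂))
        ∎
      where cross = surdDominant-cross 0≤q₁ 0≤q₂ h₁ h₂

    surdDominant-+-< : 0ℚ ≤ q₁ → 0ℚ ≤ q₂ →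
      p₁ * p₁ < five * (q₁ * q₁) → p₂ * p₂ ≤ five * (q₂ * q₂) →
      (p₁ + p₂) * (p₁ + p₂) < five * ((q₁ + q₂) * (q₁ + q₂))
    surdDominant-+-< 0≤q₁ 0≤q₂ h₁ h₂ = begin-strict
      (p₁ + p₂) * (p₁ + p₂)
        ≡⟨ square-+ p₁ p₂ ⟩
      (p₁ * p₁ + p₂ * p₂) + (p₁ * p₂ + p₁ * p₂)
        <⟨ ℚ.+-mono-<-≤ (ℚ.+-mono-<-≤ h₁ h₂) (ℚ.+-mono-≤ cross cross) ⟩
      (five * (q₁ * q₁) + five * (q₂ * q₂)) + (five * (q₁ * q₂) + five * (q₁ * q₂))
        ≡⟨ five*square-+ q₁ q₂ ⟨
      five * ((q₁ + q₂) * (q₁ + q₂))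
        ∎
      where cross = surdDominant-cross 0≤q₁ 0≤q₂ (ℚ.<⇒≤ h₁) h₂

  -- Nonneg√5 p q says p + q√5 ≥ 0.  Since 2(a + bφ) = (2a + b) + b√5, the type
  -- NonNegφ (a ⊕ b φ) unfolds to Nonneg√5 (a + a + b) b.
  Nonneg√5 : ℚ → ℚ → Set
  Nonneg√5 p q = (0ℚ ≤ p × 0ℚ ≤ q)
    ⊎ ((0ℚ ≤ q × p < 0ℚ) × p * p ≤ five * (q * q))
    ⊎ ((q < 0ℚ × 0ℚ ≤ p) × five * (q * q) ≤ p * p)

  pattern both-nonNeg 0≤p 0≤q = inj₁ (0≤p , 0≤q)
  pattern surd-dominant 0≤q p<0 p²≤5q² = inj₂ (inj₁ ((0≤q , p<0) , p²≤5q²))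
  pattern rat-dominant q<0 0≤p 5q²≤p² = inj₂ (inj₂ ((q<0 , 0≤p) , 5q²≤p²))

  nonNeg√5? : ∀ p q → Dec (Nonneg√5 p q)
  nonNeg√5? p q = ((0ℚ ℚ.≤? p) ×-dec (0ℚ ℚ.≤? q))
    ⊎-dec (((0ℚ ℚ.≤? q) ×-dec (p ℚ.<? 0ℚ)) ×-dec (p * p ℚ.≤? five * (q * q)))
    ⊎-dec (((q ℚ.<? 0ℚ) ×-dec (0ℚ ℚ.≤? p)) ×-dec (five * (q * q) ℚ.≤? p * p))

  nonNeg√5-intro : ∀ {p q} → (q < 0ℚ → 0ℚ ≤ p) → (q < 0ℚ → 0ℚ ≤ p → five * (q * q) ≤ p * p) →
    (0ℚ ≤ q → p < 0ℚ → p * p ≤ five * (q * q)) → Nonneg√5 p q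
  nonNeg√5-intro {p} {q} rat-sign rat-square surd-square with q ℚ.<? 0ℚ | p ℚ.<? 0ℚ
  ... | yes q<0 | _       = rat-dominant q<0 (rat-sign q<0) (rat-square q<0 (rat-sign q<0))
  ... | no  q≮0 | yes p<0 = surd-dominant (ℚ.≮⇒≥ q≮0) p<0 (surd-square (ℚ.≮⇒≥ q≮0) p<0)
  ... | no  q≮0 | no  p≮0 = both-nonNeg (ℚ.≮⇒≥ p≮0) (ℚ.≮⇒≥ q≮0)

  nonNeg√5⇒0≤ : ∀ {a} → Nonneg√5 a 0ℚ → 0ℚ ≤ a
  nonNeg√5⇒0≤ (both-nonNeg 0≤a _)        = 0≤a
  nonNeg√5⇒0≤ (surd-dominant _ a<0 a²≤0) = ⊥-elim (≤-<-absurd a²≤0 (square-antimono-< a<0 ℚ.≤-refl))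
  nonNeg√5⇒0≤ (rat-dominant 0<0 _ _)     = ⊥-elim (ℚ.<-irrefl refl 0<0)

  module _ {p₁ q₁ p₂ q₂ : ℚ} where

    private
      p = p₁ + p₂
      q = q₁ + q₂

    nonNeg+surdDominant : 0ℚ ≤ p₁ → 0ℚ ≤ q₁ → 0ℚ ≤ q₂ → p₂ * p₂ ≤ five * (q₂ * q₂) → Nonneg√5 p q
    nonNeg+surdDominant 0≤p₁ 0≤q₁ 0≤q₂ h₂ = nonNeg√5-intro
      (λ q<0 → ⊥-elim (≤-<-absurd 0≤q q<0))
      (λ q<0 _ → ⊥-elim (≤-<-absurd 0≤q q<0))
      (λ _ p<0 → begin
        p * p             ≤⟨ square-antimono-≤ (p≤q+p 0≤p₁) (ℚ.<⇒≤ p<0) ⟩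
        p₂ * p₂           ≤⟨ h₂ ⟩
        five * (q₂ * q₂)  ≤⟨ five*-mono-≤ (square-mono-≤ 0≤q₂ (p≤q+p 0≤q₁)) ⟩
        five * (q * q)    ∎)
      where 0≤q = ℚ.+-mono-≤ 0≤q₁ 0≤q₂

    nonNeg+ratDominant : 0ℚ ≤ p₁ → 0ℚ ≤ q₁ → 0ℚ ≤ p₂ → five * (q₂ * q₂) ≤ p₂ * p₂ → Nonneg√5 p q
    nonNeg+ratDominant 0≤p₁ 0≤q₁ 0≤p₂ h₂ = nonNeg√5-intro
      (λ _ → 0≤p)
      (λ q<0 _ → begin
        five * (q * q)    ≤⟨ five*-mono-≤ (square-antimono-≤ (p≤q+p 0≤q₁) (ℚ.<⇒≤ q<0)) ⟩
        five * (q₂ * q₂)  ≤⟨ h₂ ⟩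
        p₂ * p₂           ≤⟨ square-mono-≤ 0≤p₂ (p≤q+p 0≤p₁) ⟩
        p * p             ∎)
      (λ _ p<0 → ⊥-elim (≤-<-absurd 0≤p p<0))
      where 0≤p = ℚ.+-mono-≤ 0≤p₁ 0≤p₂

    surdDominant+surdDominant : 0ℚ ≤ q₁ → p₁ * p₁ ≤ five * (q₁ * q₁) →
      0ℚ ≤ q₂ → p₂ * p₂ ≤ five * (q₂ * q₂) → Nonneg√5 p q
    surdDominant+surdDominant 0≤q₁ h₁ 0≤q₂ h₂ = nonNeg√5-intro
      (λ q<0 → ⊥-elim (≤-<-absurd 0≤q q<0))
      (λ q<0 _ → ⊥-elim (≤-<-absurd 0≤q q<0))
      (λ _ _ → surdDominant-+ {p₁} {q₁} {p₂} {q₂} 0≤q₁ 0≤q₂ h₁ h₂)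
      where 0≤q = ℚ.+-mono-≤ 0≤q₁ 0≤q₂

    ratDominant+ratDominant : 0ℚ ≤ p₁ → five * (q₁ * q₁) ≤ p₁ * p₁ →
      0ℚ ≤ p₂ → five * (q₂ * q₂) ≤ p₂ * p₂ → Nonneg√5 p q
    ratDominant+ratDominant 0≤p₁ h₁ 0≤p₂ h₂ = nonNeg√5-intro
      (λ _ → 0≤p)
      (λ _ _ → ratDominant-+ {p₁} {q₁} {p₂} {q₂} 0≤p₁ 0≤p₂ h₁ h₂)
      (λ _ p<0 → ⊥-elim (≤-<-absurd 0≤p p<0))
      where 0≤p = ℚ.+-mono-≤ 0≤p₁ 0≤p₂

    -- Each goal is refuted inside a cone: one summand is the total plus the negated other
    -- summand, and the negation of the goal puts the total strictly inside that cone.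
    surdDominant+ratDominant : 0ℚ ≤ q₁ → p₁ < 0ℚ → p₁ * p₁ ≤ five * (q₁ * q₁) →
      q₂ < 0ℚ → 0ℚ ≤ p₂ → five * (q₂ * q₂) ≤ p₂ * p₂ → Nonneg√5 p q
    surdDominant+ratDominant 0≤q₁ p₁<0 h₁ q₂<0 0≤p₂ h₂ = nonNeg√5-intro rat-sign rat-square surd-square
      where
      cancelˡ : ∀ a b → (a + b) + - a ≡ b
      cancelˡ = solve-∀ ℚ-ring
      cancelʳ : ∀ a b → (a + b) + - b ≡ a
      cancelʳ = solve-∀ ℚ-ring
      neg-cancelˡ : ∀ a b → - (a + b) + a ≡ - b
      neg-cancelˡ = solve-∀ ℚ-ring
      neg-cancelʳ : ∀ a b → - (a + b) + b ≡ - a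
      neg-cancelʳ = solve-∀ ℚ-ring

      rat-sign : q < 0ℚ → 0ℚ ≤ p
      rat-sign q<0 with 0ℚ ℚ.≤? p
      ... | yes 0≤p = 0≤p
      ... | no  0≰p = ⊥-elim (≤-<-absurd h₁ (begin-strict
        five * (q₁ * q₁)      <⟨ ℚ.*-monoʳ-<-pos five (square-mono-< 0≤q₁ (p+q<0⇒p<-q q<0)) ⟩
        five * (- q₂ * - q₂)  ≡⟨ cong (five *_) (neg-square q₂) ⟩
        five * (q₂ * q₂)      ≤⟨ h₂ ⟩
        p₂ * p₂               <⟨ square-mono-< 0≤p₂ (p+q<0⇒p<-q p₂+p₁<0) ⟩
        - p₁ * - p₁           ≡⟨ neg-square p₁ ⟩
        p₁ * p₁               ∎))
        where p₂+p₁<0 = subst (_< 0ℚ) (ℚ.+-comm p₁ p₂) (ℚ.≰⇒> 0≰p)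

      rat-square : q < 0ℚ → 0ℚ ≤ p → five * (q * q) ≤ p * p
      rat-square q<0 _ with five * (q * q) ℚ.≤? p * p
      ... | yes 5q²≤p² = 5q²≤p²
      ... | no  5q²≰p² = ⊥-elim (≤-<-absurd h₂ (begin-strict
        p₂ * p₂                          ≡⟨ cong₂ _*_ (cancelˡ p₁ p₂) (cancelˡ p₁ p₂) ⟨
        (p + - p₁) * (p + - p₁)          <⟨ surdDominant-+-< {p} { - q} { - p₁} {q₁} (0≤-a (ℚ.<⇒≤ q<0)) 0≤q₁
                                              (subst (λ x → p * p < five * x) (sym (neg-square q)) (ℚ.≰⇒> 5q²≰p²))
                                              (subst (_≤ five * (q₁ * q₁)) (sym (neg-square p₁)) h₁) ⟩
        five * ((- q + q₁) * (- q + q₁)) ≡⟨ cong (λ x → five * (x * x)) (neg-cancelˡ q₁ q₂) ⟩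
        five * (- q₂ * - q₂)             ≡⟨ cong (five *_) (neg-square q₂) ⟩
        five * (q₂ * q₂)                 ∎))

      surd-square : 0ℚ ≤ q → p < 0ℚ → p * p ≤ five * (q * q)
      surd-square _ p<0 with p * p ℚ.≤? five * (q * q)
      ... | yes p²≤5q² = p²≤5q²
      ... | no  p²≰5q² = ⊥-elim (≤-<-absurd h₁ (begin-strict
        five * (q₁ * q₁)                 ≡⟨ cong (λ x → five * (x * x)) (cancelʳ q₁ q₂) ⟨
        five * ((q + - q₂) * (q + - q₂)) <⟨ ratDominant-+-< { - p} {q} {p₂} { - q₂} (0≤-a (ℚ.<⇒≤ p<0)) 0≤p₂
                                              (subst (five * (q * q) <_) (sym (neg-square p)) (ℚ.≰⇒> p²≰5q²))
                                              (subst (λ x → five * x ≤ p₂ * p₂) (sym (neg-square q₂)) h₂) ⟩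
        (- p + p₂) * (- p + p₂)          ≡⟨ cong (λ x → x * x) (neg-cancelʳ p₁ p₂) ⟩
        - p₁ * - p₁                      ≡⟨ neg-square p₁ ⟩
        p₁ * p₁                          ∎))

  nonNeg√5-comm : ∀ p₁ q₁ p₂ q₂ → Nonneg√5 (p₂ + p₁) (q₂ + q₁) → Nonneg√5 (p₁ + p₂) (q₁ + q₂)
  nonNeg√5-comm p₁ q₁ p₂ q₂ = subst₂ Nonneg√5 (ℚ.+-comm p₂ p₁) (ℚ.+-comm q₂ q₁)

  nonNeg√5-+ : ∀ {p₁ q₁ p₂ q₂} → Nonneg√5 p₁ q₁ → Nonneg√5 p₂ q₂ → Nonneg√5 (p₁ + p₂) (q₁ + q₂)
  nonNeg√5-+ (both-nonNeg 0≤p₁ 0≤q₁) (both-nonNeg 0≤p₂ 0≤q₂) =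
    both-nonNeg (ℚ.+-mono-≤ 0≤p₁ 0≤p₂) (ℚ.+-mono-≤ 0≤q₁ 0≤q₂)
  nonNeg√5-+ {p₁} {q₁} {p₂} {q₂} (both-nonNeg 0≤p₁ 0≤q₁) (surd-dominant 0≤q₂ _ h₂) =
    nonNeg+surdDominant {p₁} {q₁} {p₂} {q₂} 0≤p₁ 0≤q₁ 0≤q₂ h₂
  nonNeg√5-+ {p₁} {q₁} {p₂} {q₂} (both-nonNeg 0≤p₁ 0≤q₁) (rat-dominant _ 0≤p₂ h₂) =
    nonNeg+ratDominant {p₁} {q₁} {p₂} {q₂} 0≤p₁ 0≤q₁ 0≤p₂ h₂
  nonNeg√5-+ {p₁} {q₁} {p₂} {q₂} (surd-dominant 0≤q₁ _ h₁) (both-nonNeg 0≤p₂ 0≤q₂) =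
    nonNeg√5-comm p₁ q₁ p₂ q₂ (nonNeg+surdDominant {p₂} {q₂} {p₁} {q₁} 0≤p₂ 0≤q₂ 0≤q₁ h₁)
  nonNeg√5-+ {p₁} {q₁} {p₂} {q₂} (surd-dominant 0≤q₁ _ h₁) (surd-dominant 0≤q₂ _ h₂) =
    surdDominant+surdDominant {p₁} {q₁} {p₂} {q₂} 0≤q₁ h₁ 0≤q₂ h₂
  nonNeg√5-+ {p₁} {q₁} {p₂} {q₂} (surd-dominant 0≤q₁ p₁<0 h₁) (rat-dominant q₂<0 0≤p₂ h₂) =
    surdDominant+ratDominant {p₁} {q₁} {p₂} {q₂} 0≤q₁ p₁<0 h₁ q₂<0 0≤p₂ h₂
  nonNeg√5-+ {p₁} {q₁} {p₂} {q₂} (rat-dominant _ 0≤p₁ h₁) (both-nonNeg 0≤p₂ 0≤q₂) =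
    nonNeg√5-comm p₁ q₁ p₂ q₂ (nonNeg+ratDominant {p₂} {q₂} {p₁} {q₁} 0≤p₂ 0≤q₂ 0≤p₁ h₁)
  nonNeg√5-+ {p₁} {q₁} {p₂} {q₂} (rat-dominant q₁<0 0≤p₁ h₁) (surd-dominant 0≤q₂ p₂<0 h₂) =
    nonNeg√5-comm p₁ q₁ p₂ q₂
      (surdDominant+ratDominant {p₂} {q₂} {p₁} {q₁} 0≤q₂ p₂<0 h₂ q₁<0 0≤p₁ h₁)
  nonNeg√5-+ {p₁} {q₁} {p₂} {q₂} (rat-dominant _ 0≤p₁ h₁) (rat-dominant _ 0≤p₂ h₂) =
    ratDominant+ratDominant {p₁} {q₁} {p₂} {q₂} 0≤p₁ h₁ 0≤p₂ h₂

  -- Multiplying p + q√5 by φ = (1 + √5)/2 or by φ⁻¹ = (√5 - 1)/2 negates the norm p² - 5q².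
  module _ {p q : ℚ} where

    private
      norm-*φ : ∀ p q → (½ * (p + five * q)) * (½ * (p + five * q)) + p * p
                       ≡ five * ((½ * (p + q)) * (½ * (p + q))) + five * (q * q)
      norm-*φ = solve-∀ ℚ-ring
      norm-*φ⁻¹ : ∀ p q → (½ * (five * q - p)) * (½ * (five * q - p)) + p * p
                         ≡ five * ((½ * (p - q)) * (½ * (p - q))) + five * (q * q)
      norm-*φ⁻¹ = solve-∀ ℚ-ring

    nonNeg√5-*φ : Nonneg√5 p q → Nonneg√5 (½ * (p + five * q)) (½ * (p + q))
    nonNeg√5-*φ (both-nonNeg 0≤p 0≤q) =
      both-nonNeg (½*-nonNeg (ℚ.+-mono-≤ 0≤p (five*-mono-≤ 0≤q))) (½*-nonNeg (ℚ.+-mono-≤ 0≤p 0≤q))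
    nonNeg√5-*φ (surd-dominant 0≤q _ p²≤5q²) = nonNeg√5-intro
      (λ _ → 0≤p')
      (λ _ _ → cancel-≤ (norm-*φ p q) p²≤5q²)
      (λ _ p'<0 → ⊥-elim (≤-<-absurd 0≤p' p'<0))
      where
      0≤p' : 0ℚ ≤ ½ * (p + five * q)
      0≤p' = ½*-nonNeg (-a≤b⇒0≤a+b {p} (square-cancel-≤ (five*-mono-≤ 0≤q) (begin
        - p * - p              ≡⟨ neg-square p ⟩
        p * p                  ≤⟨ p²≤5q² ⟩
        five * (q * q)         ≤⟨ five*square≤square-five* q ⟩
        five * q * (five * q)  ∎)))
    nonNeg√5-*φ (rat-dominant _ 0≤p 5q²≤p²) = nonNeg√5-intro
      (λ q'<0 → ⊥-elim (≤-<-absurd 0≤q' q'<0))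
      (λ q'<0 _ → ⊥-elim (≤-<-absurd 0≤q' q'<0))
      (λ _ _ → cancel-≤ (sym (norm-*φ p q)) 5q²≤p²)
      where
      0≤q' : 0ℚ ≤ ½ * (p + q)
      0≤q' = ½*-nonNeg (subst (0ℚ ≤_) (ℚ.+-comm q p) (-a≤b⇒0≤a+b {q} (square-cancel-≤ 0≤p (begin
        - q * - q       ≡⟨ neg-square q ⟩
        q * q           ≤⟨ square≤five*square q ⟩
        five * (q * q)  ≤⟨ 5q²≤p² ⟩
        p * p           ∎))))

    nonNeg√5-*φ⁻¹ : Nonneg√5 p q → Nonneg√5 (½ * (five * q - p)) (½ * (p - q))
    nonNeg√5-*φ⁻¹ (both-nonNeg 0≤p 0≤q) = nonNeg√5-intro
      (λ q'<0 → ½*-nonNeg (≤⇒0≤- (ℚ.≤-trans (p≤q q'<0) (≤-five* 0≤q))))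
      (λ q'<0 _ → cancel-≤ (norm-*φ⁻¹ p q)
                    (ℚ.≤-trans (square-mono-≤ 0≤p (p≤q q'<0)) (square≤five*square q)))
      (λ _ p'<0 → cancel-≤ (sym (norm-*φ⁻¹ p q)) (begin
        five * (q * q)         ≤⟨ five*square≤square-five* q ⟩
        five * q * (five * q)  ≤⟨ square-mono-≤ (five*-mono-≤ 0≤q) (ℚ.<⇒≤ (a-b<0⇒a<b (½*-neg⇒neg p'<0))) ⟩
        p * p                  ∎))
      where
      p≤q : ½ * (p - q) < 0ℚ → p ≤ q
      p≤q q'<0 = ℚ.<⇒≤ (a-b<0⇒a<b (½*-neg⇒neg q'<0))
    nonNeg√5-*φ⁻¹ (surd-dominant 0≤q p<0 p²≤5q²) = nonNeg√5-intro
      (λ _ → ½*-nonNeg (ℚ.+-mono-≤ (five*-mono-≤ 0≤q) (0≤-a (ℚ.<⇒≤ p<0))))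
      (λ _ _ → cancel-≤ (norm-*φ⁻¹ p q) p²≤5q²)
      (λ 0≤q' _ → ⊥-elim (≤-<-absurd 0≤q' (½*-neg (ℚ.+-mono-<-≤ p<0 (ℚ.neg-antimono-≤ 0≤q)))))
    nonNeg√5-*φ⁻¹ (rat-dominant q<0 0≤p 5q²≤p²) = nonNeg√5-intro
      (λ q'<0 → ⊥-elim (≤-<-absurd 0≤q' q'<0))
      (λ q'<0 _ → ⊥-elim (≤-<-absurd 0≤q' q'<0))
      (λ _ _ → cancel-≤ (sym (norm-*φ⁻¹ p q)) 5q²≤p²)
      where
      0≤q' : 0ℚ ≤ ½ * (p - q)
      0≤q' = ½*-nonNeg (ℚ.+-mono-≤ 0≤p (0≤-a (ℚ.<⇒≤ q<0)))

  sub-div-* : ∀ p X d .{{_ : NonZero d}} → (p - X * 1/ d) * d ≡ p * d - X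
  sub-div-* p X d = begin-equality
    (p - X * 1/ d) * d      ≡⟨ expand p X (1/ d) d ⟩
    p * d - X * (1/ d * d)  ≡⟨ cong (λ t → p * d - X * t) (ℚ.*-inverseˡ d) ⟩
    p * d - X * 1ℚ          ≡⟨ cong (λ t → p * d - t) (ℚ.*-identityʳ X) ⟩
    p * d - X               ∎
    where expand : ∀ p X i d → (p - X * i) * d ≡ p * d - X * (i * d)
          expand = solve-∀ ℚ-ring

  -- In the two mixed-sign cases c is the
  -- norm |p² - 5q²| divided by d, a rational upper bound of the conjugate |p - q√5|; then
  -- ±(p - c) d is a product of nonnegative factors, and (p - c)² d² and 5q² d² differ by
  -- 4q²|p² - 5q²|.
  module _ {p q : ℚ} where

    exceeds-ratDominant : q < 0ℚ → 0ℚ < p → five * (q * q) < p * p → ∃[ c ] (0ℚ < c × Nonneg√5 (p - c) q)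
    exceeds-ratDominant q<0 0<p 5q²<p² = c , 0<c , rat-dominant q<0 0≤r 5q²≤r²
      where
      0≤p = ℚ.<⇒≤ 0<p
      0≤-q = 0≤-a (ℚ.<⇒≤ q<0)
      d = p + ((- q + - q) + - q)
      0<d : 0ℚ < d
      0<d = ℚ.+-mono-<-≤ 0<p (ℚ.+-mono-≤ (ℚ.+-mono-≤ 0≤-q 0≤-q) 0≤-q)
      instance
        d≢0 : NonZero d
        d≢0 = ℚ.pos⇒nonZero d {{positive 0<d}}
      X = p * p - five * (q * q)
      0<X = <⇒0<- 5q²<p²
      c = X * 1/ d
      0<c : 0ℚ < c
      0<c = ℚ.positive⁻¹ c {{ℚ.pos*pos⇒pos X {{positive 0<X}} (1/ d) {{ℚ.1/pos⇒pos d {{positive 0<d}}}}}}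
      r = p - c
      Y = - q * ((p + p + p) + five * - q)
      rd≡Y : r * d ≡ Y
      rd≡Y = trans (sub-div-* p X d) (identity p q)
        where identity : ∀ p q → p * (p + ((- q + - q) + - q)) - (p * p - five * (q * q))
                                ≡ - q * ((p + p + p) + five * - q)
              identity = solve-∀ ℚ-ring
      0≤r : 0ℚ ≤ r
      0≤r = *-cancelʳ-nonNeg 0<d (subst (0ℚ ≤_) (sym rd≡Y)
              (*-mono-≤-nonNeg ℚ.≤-refl 0≤-q ℚ.≤-refl
                (ℚ.+-mono-≤ (ℚ.+-mono-≤ (ℚ.+-mono-≤ 0≤p 0≤p) 0≤p) (five*-mono-≤ 0≤-q))))
      5q²≤r² : five * (q * q) ≤ r * r
      5q²≤r² = *-cancelʳ-square-≤ 0<d (begin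
        five * (q * q) * (d * d)  ≤⟨ 0≤-⇒≤ (subst (0ℚ ≤_) (sym (gap p q)) 0≤gap) ⟩
        Y * Y                     ≡⟨ cong₂ _*_ rd≡Y rd≡Y ⟨
        (r * d) * (r * d)         ≡⟨ regroup r d ⟩
        r * r * (d * d)           ∎)
        where
        gap : ∀ p q → (- q * ((p + p + p) + five * - q)) * (- q * ((p + p + p) + five * - q))
                      - five * (q * q) * ((p + ((- q + - q) + - q)) * (p + ((- q + - q) + - q)))
                    ≡ (q * q) * (((p * p - five * (q * q)) + (p * p - five * (q * q)))
                                 + ((p * p - five * (q * q)) + (p * p - five * (q * q))))
        gap = solve-∀ ℚ-ring
        0≤X = ℚ.<⇒≤ 0<X
        0≤gap = *-mono-≤-nonNeg ℚ.≤-refl (square-nonNeg q) ℚ.≤-refl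
                  (ℚ.+-mono-≤ (ℚ.+-mono-≤ 0≤X 0≤X) (ℚ.+-mono-≤ 0≤X 0≤X))
        regroup : ∀ r d → (r * d) * (r * d) ≡ r * r * (d * d)
        regroup = solve-∀ ℚ-ring

    exceeds-surdDominant : 0ℚ < q → p < 0ℚ → p * p < five * (q * q) → ∃[ c ] (0ℚ < c × Nonneg√5 (p - c) q)
    exceeds-surdDominant 0<q p<0 p²<5q² = c , 0<c , surd-dominant 0≤q r<0 r²≤5q²
      where
      0≤q = ℚ.<⇒≤ 0<q
      0≤-p = 0≤-a (ℚ.<⇒≤ p<0)
      d = ((q + q) + q) + - p
      0<d : 0ℚ < d
      0<d = ℚ.+-mono-<-≤ (ℚ.+-mono-<-≤ (ℚ.+-mono-<-≤ 0<q 0≤q) 0≤q) 0≤-p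
      instance
        d≢0 : NonZero d
        d≢0 = ℚ.pos⇒nonZero d {{positive 0<d}}
      X = five * (q * q) - p * p
      0<X = <⇒0<- p²<5q²
      c = X * 1/ d
      0<c : 0ℚ < c
      0<c = ℚ.positive⁻¹ c {{ℚ.pos*pos⇒pos X {{positive 0<X}} (1/ d) {{ℚ.1/pos⇒pos d {{positive 0<d}}}}}}
      r = p - c
      r<0 : r < 0ℚ
      r<0 = ℚ.+-mono-<-≤ p<0 (ℚ.neg-antimono-≤ (ℚ.<⇒≤ 0<c))
      Y = q * (five * q + ((- p + - p) + - p))
      -rd≡Y : - r * d ≡ Y
      -rd≡Y = trans (sym (ℚ.neg-distribˡ-* r d)) (trans (cong -_ (sub-div-* p X d)) (identity p q))
        where identity : ∀ p q → - (p * (((q + q) + q) + - p) - (five * (q * q) - p * p))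
                                ≡ q * (five * q + ((- p + - p) + - p))
              identity = solve-∀ ℚ-ring
      r²≤5q² : r * r ≤ five * (q * q)
      r²≤5q² = *-cancelʳ-square-≤ 0<d (begin
        r * r * (d * d)           ≡⟨ regroup r d ⟩
        (- r * d) * (- r * d)     ≡⟨ cong₂ _*_ -rd≡Y -rd≡Y ⟩
        Y * Y                     ≤⟨ 0≤-⇒≤ (subst (0ℚ ≤_) (sym (gap p q)) 0≤gap) ⟩
        five * (q * q) * (d * d)  ∎)
        where
        gap : ∀ p q → five * (q * q) * ((((q + q) + q) + - p) * (((q + q) + q) + - p))
                      - (q * (five * q + ((- p + - p) + - p))) * (q * (five * q + ((- p + - p) + - p)))
                    ≡ (q * q) * (((five * (q * q) - p * p) + (five * (q * q) - p * p))
                                 + ((five * (q * q) - p * p) + (five * (q * q) - p * p)))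
        gap = solve-∀ ℚ-ring
        0≤X = ℚ.<⇒≤ 0<X
        0≤gap = *-mono-≤-nonNeg ℚ.≤-refl (square-nonNeg q) ℚ.≤-refl
                  (ℚ.+-mono-≤ (ℚ.+-mono-≤ 0≤X 0≤X) (ℚ.+-mono-≤ 0≤X 0≤X))
        regroup : ∀ r d → r * r * (d * d) ≡ (- r * d) * (- r * d)
        regroup = solve-∀ ℚ-ring

    exceeds-nonNeg : 0ℚ ≤ q → 0ℚ < p + q → ∃[ c ] (0ℚ < c × Nonneg√5 (p - c) q)
    exceeds-nonNeg 0≤q 0<p+q = p + q , 0<p+q , subst (λ x → Nonneg√5 x q) (sym (sub-sum p q)) (nonNeg√5-intro
      (λ q<0 → ⊥-elim (≤-<-absurd 0≤q q<0))
      (λ q<0 _ → ⊥-elim (≤-<-absurd 0≤q q<0))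
      (λ _ _ → subst (_≤ five * (q * q)) (sym (neg-square q)) (square≤five*square q)))
      where sub-sum : ∀ p q → p - (p + q) ≡ - q
            sub-sum = solve-∀ ℚ-ring

  ¬nonNeg√5⇒exceeds : ∀ {p q} → ¬ Nonneg√5 p q → ∃[ c ] (0ℚ < c × Nonneg√5 (- p - c) (- q))
  ¬nonNeg√5⇒exceeds {p} {q} ¬nonNeg with 0ℚ ℚ.<? q | 0ℚ ℚ.<? p
  ... | yes 0<q | _ = exceeds-ratDominant { - p} { - q} (ℚ.neg-antimono-< 0<q) 0<-p 5q²<p²
    where
    0<-p : 0ℚ < - p
    0<-p with p ℚ.<? 0ℚ
    ... | yes p<0 = 0<-a p<0
    ... | no  p≮0 = ⊥-elim (¬nonNeg (both-nonNeg (ℚ.≮⇒≥ p≮0) (ℚ.<⇒≤ 0<q)))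
    5q²<p² : five * (- q * - q) < - p * - p
    5q²<p² with p * p ℚ.≤? five * (q * q)
    ... | yes p²≤5q² = ⊥-elim (¬nonNeg (surd-dominant (ℚ.<⇒≤ 0<q) (0<-a⇒a<0 0<-p) p²≤5q²))
    ... | no  p²≰5q² =
      subst₂ (λ x y → five * x < y) (sym (neg-square q)) (sym (neg-square p)) (ℚ.≰⇒> p²≰5q²)
  ... | no 0≮q | yes 0<p = exceeds-surdDominant { - p} { - q} 0<-q (ℚ.neg-antimono-< 0<p) p²<5q²
    where
    0<-q : 0ℚ < - q
    0<-q with q ℚ.<? 0ℚ
    ... | yes q<0 = 0<-a q<0
    ... | no  q≮0 = ⊥-elim (¬nonNeg (both-nonNeg (ℚ.<⇒≤ 0<p) (ℚ.≮⇒≥ q≮0)))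
    p²<5q² : - p * - p < five * (- q * - q)
    p²<5q² with five * (q * q) ℚ.≤? p * p
    ... | yes 5q²≤p² = ⊥-elim (¬nonNeg (rat-dominant (0<-a⇒a<0 0<-q) (ℚ.<⇒≤ 0<p) 5q²≤p²))
    ... | no  5q²≰p² =
      subst₂ (λ x y → x < five * y) (sym (neg-square p)) (sym (neg-square q)) (ℚ.≰⇒> 5q²≰p²)
  ... | no 0≮q | no 0≮p = exceeds-nonNeg { - p} { - q} 0≤-q 0<-p-q
    where
    0≤-q = 0≤-a (ℚ.≮⇒≥ 0≮q)
    0<-p-q : 0ℚ < - p + - q
    0<-p-q with 0ℚ ℚ.<? - p + - q
    ... | yes 0<-p-q = 0<-p-q
    ... | no  0≮-p-q = ⊥-elim (¬nonNeg (both-nonNeg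
            (-a≤0⇒0≤a (ℚ.≤-trans (p≤p+q 0≤-q) -p-q≤0))
            (-a≤0⇒0≤a (ℚ.≤-trans (p≤q+p (0≤-a (ℚ.≮⇒≥ 0≮p))) -p-q≤0))))
      where -p-q≤0 = ℚ.≮⇒≥ 0≮-p-q

  nonNeg√5-archimedean : ∀ {p q} → (∀ ε → 0ℚ < ε → Nonneg√5 (p + (ε + ε)) q) → Nonneg√5 p q
  nonNeg√5-archimedean {p} {q} nonNeg+ε with nonNeg√5? p q
  ... | yes nonNeg = nonNeg
  ... | no  ¬nonNeg with ¬nonNeg√5⇒exceeds ¬nonNeg
  ...   | c , 0<c , nonNeg-c = ⊥-elim (≤-<-absurd
            (nonNeg√5⇒0≤ (subst₂ Nonneg√5 (sum p c) (ℚ.+-inverseʳ q)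
              (nonNeg√5-+ (nonNeg+ε ε 0<ε) nonNeg-c)))
            (ℚ.neg-antimono-< (ℚ.*-monoʳ-<-pos ½ 0<c)))
    where
    ε = ½ * (½ * c)
    0<ε = ℚ.*-monoʳ-<-pos ½ (ℚ.*-monoʳ-<-pos ½ 0<c)
    sum : ∀ p c → (p + (½ * (½ * c) + ½ * (½ * c))) + (- p - c) ≡ - (½ * c)
    sum = solve-∀ ℚ-ring

-- The order of ℚ(φ)

nonNegφ? : ∀ z → Dec (NonNegφ z)
nonNegφ? z = nonNeg√5? (re z + re z + im z) (im z)

nonNegφ-+ : ∀ z w → NonNegφ z → NonNegφ w → NonNegφ (z +φ w)
nonNegφ-+ z w z≥0 w≥0 =
  subst (λ p → Nonneg√5 p (im z + im w)) (regroup (re z) (im z) (re w) (im w)) (nonNeg√5-+ z≥0 w≥0)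
  where regroup : ∀ a b c d → (a + a + b) + (c + c + d) ≡ (a + c) + (a + c) + (b + d)
        regroup = solve-∀ ℚ-ring

nonNegφ-*φ : ∀ z → NonNegφ z → NonNegφ (z *φ φ̂)
nonNegφ-*φ z z≥0 = subst₂ Nonneg√5 (coord-p (re z) (im z)) (coord-q (re z) (im z)) (nonNeg√5-*φ z≥0)
  where
  coord-p : ∀ a b → ½ * ((a + a + b) + five * b)
                  ≡ (a * 0ℚ + b * 1ℚ) + (a * 0ℚ + b * 1ℚ) + (a * 1ℚ + b * 0ℚ + b * 1ℚ)
  coord-p = solve-∀ ℚ-ring
  coord-q : ∀ a b → ½ * ((a + a + b) + b) ≡ a * 1ℚ + b * 0ℚ + b * 1ℚ
  coord-q = solve-∀ ℚ-ring

nonNegφ-*φ⁻¹ : ∀ z → NonNegφ z → NonNegφ (z *φ φ⁻¹)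
nonNegφ-*φ⁻¹ z z≥0 = subst₂ Nonneg√5 (coord-p (re z) (im z)) (coord-q (re z) (im z)) (nonNeg√5-*φ⁻¹ z≥0)
  where
  coord-p : ∀ a b → ½ * (five * b - (a + a + b))
                  ≡ (a * - 1ℚ + b * 1ℚ) + (a * - 1ℚ + b * 1ℚ) + (a * 1ℚ + b * - 1ℚ + b * 1ℚ)
  coord-p = solve-∀ ℚ-ring
  coord-q : ∀ a b → ½ * ((a + a + b) - b) ≡ a * 1ℚ + b * - 1ℚ + b * 1ℚ
  coord-q = solve-∀ ℚ-ring

-- _≤φ_ with a rigid head: _≤φ_ unfolds into rational inequalities, from which Agda
-- cannot recover the endpoints by unification.
infix 4 _≼_ _≼?_
record _≼_ (x y : Qφ) : Set where
  constructor ≤φ⇒≼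
  field ≼⇒≤φ : x ≤φ y
open _≼_ public

_≼?_ : Decidable _≼_
x ≼? y = map′ ≤φ⇒≼ ≼⇒≤φ (nonNegφ? (y -φ x))

≼-reflexive : ∀ {x y} → x ≡ y → x ≼ y
≼-reflexive {x} refl = ≤φ⇒≼ (subst NonNegφ (sym (sub-self x)) (from-yes (nonNegφ? 0φ)))
  where sub-self : ∀ x → x -φ x ≡ 0φ
        sub-self = solve-∀ Qφ-ring

≼-trans : ∀ {x y z} → x ≼ y → y ≼ z → x ≼ z
≼-trans {x} {y} {z} (≤φ⇒≼ x≤y) (≤φ⇒≼ y≤z) =
  ≤φ⇒≼ (subst NonNegφ (telescope x y z) (nonNegφ-+ (z -φ y) (y -φ x) y≤z x≤y))
  where telescope : ∀ x y z → (z -φ y) +φ (y -φ x) ≡ z -φ x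
        telescope = solve-∀ Qφ-ring

≼-isPreorder : IsPreorder _≡_ _≼_
≼-isPreorder = record { isEquivalence = isEquivalence ; reflexive = ≼-reflexive ; trans = ≼-trans }

module ≼-Reasoning where
  open import Relation.Binary.Reasoning.Base.Double ≼-isPreorder public
  open import Relation.Binary.Reasoning.Syntax using (module ≤-syntax)
  open ≤-syntax _IsRelatedTo_ _IsRelatedTo_ ≲-go public

+φ-mono-≼ : ∀ {x y u v} → x ≼ y → u ≼ v → x +φ u ≼ y +φ v
+φ-mono-≼ {x} {y} {u} {v} (≤φ⇒≼ x≤y) (≤φ⇒≼ u≤v) =
  ≤φ⇒≼ (subst NonNegφ (regroup x y u v) (nonNegφ-+ (y -φ x) (v -φ u) x≤y u≤v))
  where regroup : ∀ x y u v → (y -φ x) +φ (v -φ u) ≡ (y +φ v) -φ (x +φ u)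
        regroup = solve-∀ Qφ-ring

+φ-monoʳ-≼ : ∀ x {u v} → u ≼ v → x +φ u ≼ x +φ v
+φ-monoʳ-≼ x = +φ-mono-≼ (≼-reflexive {x} refl)

+φ-monoˡ-≼ : ∀ x {u v} → u ≼ v → u +φ x ≼ v +φ x
+φ-monoˡ-≼ x u≤v = +φ-mono-≼ u≤v (≼-reflexive {x} refl)

x≼x+φy : ∀ {x y} → 0φ ≼ y → x ≼ x +φ y
x≼x+φy {x} {y} 0≤y = subst (_≼ x +φ y) (x+φ0 x) (+φ-monoʳ-≼ x 0≤y)
  where x+φ0 : ∀ x → x +φ 0φ ≡ x
        x+φ0 = solve-∀ Qφ-ring

≼⇒0≼- : ∀ {x y} → x ≼ y → 0φ ≼ y -φ x
≼⇒0≼- {x} {y} x≤y = subst (_≼ y -φ x) (sub-self x) (+φ-monoˡ-≼ (-φ x) x≤y)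
  where sub-self : ∀ x → x -φ x ≡ 0φ
        sub-self = solve-∀ Qφ-ring

≼+⇒-≼ : ∀ {x y t} → y ≼ x +φ t → y -φ x ≼ t
≼+⇒-≼ {x} {y} {t} y≤x+t = subst (y -φ x ≼_) (add-sub x t) (+φ-monoˡ-≼ (-φ x) y≤x+t)
  where add-sub : ∀ x t → (x +φ t) -φ x ≡ t
        add-sub = solve-∀ Qφ-ring

-φ-antimono-≼ : ∀ {x y} → x ≼ y → -φ y ≼ -φ x
-φ-antimono-≼ {x} {y} (≤φ⇒≼ x≤y) = ≤φ⇒≼ (subst NonNegφ (regroup x y) x≤y)
  where regroup : ∀ x y → y -φ x ≡ (-φ x) -φ (-φ y)
        regroup = solve-∀ Qφ-ring

*φ-monoʳ-≼-φ : ∀ {x y} → x ≼ y → x *φ φ̂ ≼ y *φ φ̂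
*φ-monoʳ-≼-φ {x} {y} (≤φ⇒≼ x≤y) = ≤φ⇒≼ (subst NonNegφ (distrib x y) (nonNegφ-*φ (y -φ x) x≤y))
  where distrib : ∀ x y → (y -φ x) *φ φ̂ ≡ y *φ φ̂ -φ x *φ φ̂
        distrib = solve-∀ Qφ-ring

*φ-monoʳ-≼-φ⁻¹ : ∀ {x y} → x ≼ y → x *φ φ⁻¹ ≼ y *φ φ⁻¹
*φ-monoʳ-≼-φ⁻¹ {x} {y} (≤φ⇒≼ x≤y) = ≤φ⇒≼ (subst NonNegφ (distrib x y) (nonNegφ-*φ⁻¹ (y -φ x) x≤y))
  where distrib : ∀ x y → (y -φ x) *φ φ⁻¹ ≡ y *φ φ⁻¹ -φ x *φ φ⁻¹
        distrib = solve-∀ Qφ-ring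

*φ-monoʳ-≼-φ^ : ∀ k {x y} → x ≼ y → x *φ φ^ k ≼ y *φ φ^ k
*φ-monoʳ-≼-φ^ zero    {x} {y} x≤y = subst₂ _≼_ (sym (*φ-1 x)) (sym (*φ-1 y)) x≤y
  where *φ-1 : ∀ x → x *φ 1φ ≡ x
        *φ-1 = solve-∀ Qφ-ring
*φ-monoʳ-≼-φ^ (suc k) {x} {y} x≤y =
  subst₂ _≼_ (assoc x (φ^ k)) (assoc y (φ^ k)) (*φ-monoʳ-≼-φ (*φ-monoʳ-≼-φ^ k x≤y))
  where assoc : ∀ x p → (x *φ p) *φ φ̂ ≡ x *φ (p *φ φ̂)
        assoc = solve-∀ Qφ-ring

*φ-monoʳ-≼-√5 : ∀ {x y} → x ≼ y → x *φ √5 ≼ y *φ √5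
*φ-monoʳ-≼-√5 {x} {y} x≤y =
  subst₂ _≼_ (split x) (split y) (+φ-mono-≼ (*φ-monoʳ-≼-φ x≤y) (*φ-monoʳ-≼-φ⁻¹ x≤y))
  where split : ∀ x → x *φ φ̂ +φ x *φ φ⁻¹ ≡ x *φ √5
        split = solve-∀ Qφ-ring

≼-archimedean : ∀ {x y} → (∀ ε → 0ℚ < ε → x ≼ y +φ ofℚ ε) → x ≼ y
≼-archimedean {x} {y} x≤y+ε = ≤φ⇒≼ (nonNeg√5-archimedean λ ε 0<ε →
  subst₂ Nonneg√5 (coord-p (re x) (im x) (re y) (im y) ε) (coord-q (im x) (im y)) (≼⇒≤φ (x≤y+ε ε 0<ε)))
  where
  coord-p : ∀ a b c d ε → ((c + ε) + - a) + ((c + ε) + - a) + ((d + 0ℚ) + - b)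
                        ≡ ((c + - a) + (c + - a) + (d + - b)) + (ε + ε)
  coord-p = solve-∀ ℚ-ring
  coord-q : ∀ b d → (d + 0ℚ) + - b ≡ d + - b
  coord-q = solve-∀ ℚ-ring

φ^-*φ^ : ∀ k → φ^- k *φ φ^ k ≡ 1φ
φ^-*φ^ zero    = refl
φ^-*φ^ (suc k) = trans (regroup (φ^- k) (φ^ k)) (φ^-*φ^ k)
  where regroup : ∀ a b → (a *φ φ⁻¹) *φ (b *φ φ̂) ≡ a *φ b
        regroup = solve-∀ Qφ-ring

0≼φ^- : ∀ k → 0φ ≼ φ^- k
0≼φ^- zero    = from-yes (0φ ≼? 1φ)
0≼φ^- (suc k) = subst (_≼ φ^- (suc k)) (zero-* φ⁻¹) (*φ-monoʳ-≼-φ⁻¹ (0≼φ^- k))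
  where zero-* : ∀ x → 0φ *φ x ≡ 0φ
        zero-* = solve-∀ Qφ-ring

φ^-≰0 : ∀ k → ¬ (φ^- k ≼ 0φ)
φ^-≰0 k φ^-k≤0 = from-no (1φ ≼? 0φ) (subst₂ _≼_ (φ^-*φ^ k) (zero-* (φ^ k)) (*φ-monoʳ-≼-φ^ k φ^-k≤0))
  where zero-* : ∀ x → 0φ *φ x ≡ 0φ
        zero-* = solve-∀ Qφ-ring

φ^-suc≼φ^- : ∀ k → φ^- (suc k) ≼ φ^- k
φ^-suc≼φ^- k = subst (φ^- (suc k) ≼_) (sum (φ^- k)) (x≼x+φy (0≼φ^- (suc (suc k))))
  where sum : ∀ a → a *φ φ⁻¹ +φ (a *φ φ⁻¹) *φ φ⁻¹ ≡ a
        sum = solve-∀ Qφ-ring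

φ^-≼1 : ∀ k → φ^- k ≼ 1φ
φ^-≼1 zero    = ≼-reflexive refl
φ^-≼1 (suc k) = ≼-trans (φ^-suc≼φ^- k) (φ^-≼1 k)

ofℕ-+ : ∀ m n → ofℕ (m ℕ.+ n) ≡ ofℕ m +φ ofℕ n
ofℕ-+ m n = cong ofℚ (fromℕ-+ m n)
  where
  fromℕ≡mkℚ : ∀ n → + n / 1 ≡ mkℚ (+ n) 0 (Coprime.sym (Coprime.1-coprimeTo n))
  fromℕ≡mkℚ n = ℚ.normalize-coprime (Coprime.sym (Coprime.1-coprimeTo n))
  fromℕ-+ : ∀ m n → + (m ℕ.+ n) / 1 ≡ + m / 1 + + n / 1
  fromℕ-+ m n rewrite fromℕ≡mkℚ m | fromℕ≡mkℚ n | ℤ.*-identityʳ (+ m) | ℤ.*-identityʳ (+ n) = refl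

0≼ofℕ : ∀ n → 0φ ≼ ofℕ n
0≼ofℕ zero    = ≼-reflexive refl
0≼ofℕ (suc n) = subst (0φ ≼_) (sym (ofℕ-+ 1 n)) (≼-trans (from-yes (0φ ≼? 1φ)) (x≼x+φy (0≼ofℕ n)))

-- Partial sums of a digit sequence

NoConsecutiveOnes : (ℕ → Bool) → Set
NoConsecutiveOnes d = ∀ i → 1 ℕ.≤ i → d i ∧ d (suc i) ≡ false

lastDigit : (ℕ → Bool) → ℕ → Bool
lastDigit d zero    = false
lastDigit d (suc k) = d (suc k)

lastDigit-∧ : ∀ {d} → NoConsecutiveOnes d → ∀ k → lastDigit d k ∧ d (suc k) ≡ false
lastDigit-∧ no11 zero    = refl
lastDigit-∧ no11 (suc k) = no11 (suc k) (s≤s z≤n)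

-- What the digits after the k-th can add at most when no two consecutive digits are 1.
tailBound : Bool → ℕ → Qφ
tailBound b k = if b then φ^- (suc k) else φ^- k

partialφ⁺ : (ℕ → Bool) → ℕ → Qφ
partialφ⁺ d k = partialφ d k +φ tailBound (lastDigit d k) k

0≼digit : ∀ b k → 0φ ≼ (if b then φ^- k else 0φ)
0≼digit true  k = 0≼φ^- k
0≼digit false k = ≼-reflexive refl

0≼tailBound : ∀ b k → 0φ ≼ tailBound b k
0≼tailBound true  k = 0≼φ^- (suc k)
0≼tailBound false k = 0≼φ^- k

partialφ-mono : ∀ d {m n} → m ℕ.≤ n → partialφ d m ≼ partialφ d n
partialφ-mono d m≤n = go (ℕ.≤⇒≤′ m≤n)
  where
  go : ∀ {m n} → m ℕ.≤′ n → partialφ d m ≼ partialφ d n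
  go ℕ.≤′-refl           = ≼-reflexive refl
  go (ℕ.≤′-step {n} m≤n) = ≼-trans (go m≤n) (x≼x+φy (0≼digit (d (suc n)) (suc n)))

partialφ≼partialφ⁺ : ∀ d k → partialφ d k ≼ partialφ⁺ d k
partialφ≼partialφ⁺ d k = x≼x+φy (0≼tailBound (lastDigit d k) k)

partialφ⁺-suc : ∀ {d} → NoConsecutiveOnes d → ∀ k → partialφ⁺ d (suc k) ≼ partialφ⁺ d k
partialφ⁺-suc {d} no11 k = step (partialφ d k) k (lastDigit d k) (d (suc k)) (lastDigit-∧ no11 k)
  where
  drop-0 : ∀ s t → (s +φ 0φ) +φ t ≡ s +φ t
  drop-0 = solve-∀ Qφ-ring
  two-digits : ∀ s a → (s +φ a *φ φ⁻¹) +φ (a *φ φ⁻¹) *φ φ⁻¹ ≡ s +φ a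
  two-digits = solve-∀ Qφ-ring
  step : ∀ s k b₁ b₂ → b₁ ∧ b₂ ≡ false →
    (s +φ (if b₂ then φ^- (suc k) else 0φ)) +φ tailBound b₂ (suc k) ≼ s +φ tailBound b₁ k
  step s k true  false _ = ≼-reflexive (drop-0 s (φ^- (suc k)))
  step s k false false _ =
    subst (_≼ s +φ φ^- k) (sym (drop-0 s (φ^- (suc k)))) (+φ-monoʳ-≼ s (φ^-suc≼φ^- k))
  step s k false true  _ = ≼-reflexive (two-digits s (φ^- k))

partialφ⁺-antitone : ∀ {d} → NoConsecutiveOnes d → ∀ {m n} → m ℕ.≤ n → partialφ⁺ d n ≼ partialφ⁺ d m
partialφ⁺-antitone {d} no11 m≤n = go (ℕ.≤⇒≤′ m≤n)
  where
  go : ∀ {m n} → m ℕ.≤′ n → partialφ⁺ d n ≼ partialφ⁺ d m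
  go ℕ.≤′-refl           = ≼-reflexive refl
  go (ℕ.≤′-step {n} m≤n) = ≼-trans (partialφ⁺-suc no11 n) (go m≤n)

expansion≼partialφ⁺ : ∀ {d x} → NoConsecutiveOnes d → IsExpansion d x → ∀ k → x ≼ partialφ⁺ d k
expansion≼partialφ⁺ {d} {x} no11 (_ , converges) k = ≼-archimedean x≤S⁺+ε
  where
  open ≼-Reasoning
  x≤S⁺+ε : ∀ ε → 0ℚ < ε → x ≼ partialφ⁺ d k +φ ofℚ ε
  x≤S⁺+ε ε 0<ε with converges ε 0<ε
  ... | n , (x-Sₙ≤ε , _) = begin
    x                                    ≡⟨ split x (partialφ d n) ⟩
    partialφ d n +φ (x -φ partialφ d n)  ≤⟨ +φ-mono-≼ Sₙ≤S⁺ₖ (≤φ⇒≼ x-Sₙ≤ε) ⟩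
    partialφ⁺ d k +φ ofℚ ε               ∎
    where
    split : ∀ x s → x ≡ s +φ (x -φ s)
    split = solve-∀ Qφ-ring
    Sₙ≤S⁺ₖ : partialφ d n ≼ partialφ⁺ d k
    Sₙ≤S⁺ₖ = ≼-trans (partialφ-mono d (ℕ.m≤m+n n k))
               (≼-trans (partialφ≼partialφ⁺ d (n ℕ.+ k)) (partialφ⁺-antitone no11 (ℕ.m≤n+m k n)))

-- The digits read as an integer of ℤ[φ] and its conjugate

ψ̂ : Qφ
ψ̂ = 1φ -φ φ̂

-- The digits d₁ … d_k read as Σ_j d_j φ^(k-j) = intCoeff d k + φCoeff d k · φ.
intCoeff φCoeff : (ℕ → Bool) → ℕ → ℕ
intCoeff d zero    = 0
intCoeff d (suc k) = φCoeff d k ℕ.+ bit (d (suc k))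
φCoeff d zero    = 0
φCoeff d (suc k) = intCoeff d k ℕ.+ φCoeff d k

digitsφ digitsψ : (ℕ → Bool) → ℕ → Qφ
digitsφ d k = ofℕ (intCoeff d k) +φ ofℕ (φCoeff d k) *φ φ̂
digitsψ d k = ofℕ (intCoeff d k) +φ ofℕ (φCoeff d k) *φ ψ̂

digit-*φ^ : ∀ b k → (if b then φ^- k else 0φ) *φ φ^ k ≡ ofℕ (bit b)
digit-*φ^ true  k = φ^-*φ^ k
digit-*φ^ false k = zero-* (φ^ k)
  where zero-* : ∀ x → 0φ *φ x ≡ 0φ
        zero-* = solve-∀ Qφ-ring

partialφ-*φ^ : ∀ d k → partialφ d k *φ φ^ k ≡ digitsφ d k
partialφ-*φ^ d zero    = refl
partialφ-*φ^ d (suc k) = begin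
  (partialφ d k +φ t) *φ (φ^ k *φ φ̂)
    ≡⟨ distrib (partialφ d k) t (φ^ k) ⟩
  (partialφ d k *φ φ^ k) *φ φ̂ +φ t *φ (φ^ k *φ φ̂)
    ≡⟨ cong₂ (λ u v → u *φ φ̂ +φ v) (partialφ-*φ^ d k) (digit-*φ^ b (suc k)) ⟩
  digitsφ d k *φ φ̂ +φ ofℕ (bit b)
    ≡⟨ shift (ofℕ (intCoeff d k)) (ofℕ (φCoeff d k)) (ofℕ (bit b)) ⟩
  (ofℕ (φCoeff d k) +φ ofℕ (bit b)) +φ (ofℕ (intCoeff d k) +φ ofℕ (φCoeff d k)) *φ φ̂
    ≡⟨ cong₂ (λ u v → u +φ v *φ φ̂) (ofℕ-+ (φCoeff d k) (bit b)) (ofℕ-+ (intCoeff d k) (φCoeff d k)) ⟨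
  digitsφ d (suc k)
    ∎
  where
  open ≡-Reasoning
  b = d (suc k)
  t = if b then φ^- (suc k) else 0φ
  distrib : ∀ s t p → (s +φ t) *φ (p *φ φ̂) ≡ (s *φ p) *φ φ̂ +φ t *φ (p *φ φ̂)
  distrib = solve-∀ Qφ-ring
  shift : ∀ a b c → (a +φ b *φ φ̂) *φ φ̂ +φ c ≡ (b +φ c) +φ (a +φ b) *φ φ̂
  shift = solve-∀ Qφ-ring

digitsψ-suc : ∀ d k → digitsψ d (suc k) ≡ ofℕ (bit (d (suc k))) +φ ψ̂ *φ digitsψ d k
digitsψ-suc d k = begin
  digitsψ d (suc k)
    ≡⟨ cong₂ (λ u v → u +φ v *φ ψ̂) (ofℕ-+ (φCoeff d k) (bit b)) (ofℕ-+ (intCoeff d k) (φCoeff d k)) ⟩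
  (ofℕ (φCoeff d k) +φ ofℕ (bit b)) +φ (ofℕ (intCoeff d k) +φ ofℕ (φCoeff d k)) *φ ψ̂
    ≡⟨ shift (ofℕ (intCoeff d k)) (ofℕ (φCoeff d k)) (ofℕ (bit b)) ⟩
  ofℕ (bit b) +φ ψ̂ *φ digitsψ d k
    ∎
  where
  open ≡-Reasoning
  b = d (suc k)
  shift : ∀ a b c → (b +φ c) +φ (a +φ b) *φ ψ̂ ≡ c +φ ψ̂ *φ (a +φ b *φ ψ̂)
  shift = solve-∀ Qφ-ring

digitsφ-digitsψ : ∀ d k → digitsφ d k -φ digitsψ d k ≡ ofℕ (φCoeff d k) *φ √5
digitsφ-digitsψ d k = difference (ofℕ (intCoeff d k)) (ofℕ (φCoeff d k))
  where difference : ∀ a b → (a +φ b *φ φ̂) -φ (a +φ b *φ ψ̂) ≡ b *φ √5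
        difference = solve-∀ Qφ-ring

*φ-antimonoˡ-≼-ψ : ∀ {x y} → x ≼ y → ψ̂ *φ y ≼ ψ̂ *φ x
*φ-antimonoˡ-≼-ψ {x} {y} x≤y = subst₂ _≼_ (ψ-* y) (ψ-* x) (-φ-antimono-≼ (*φ-monoʳ-≼-φ⁻¹ x≤y))
  where ψ-* : ∀ x → -φ (x *φ φ⁻¹) ≡ ψ̂ *φ x
        ψ-* = solve-∀ Qφ-ring

-- Bounds on the conjugate of the digits read in ℤ[φ], according to the last digit; the
-- slack μ is φ^-(k+1) after k digits.
ConjugateBounds : Bool → Qφ → Qφ → Set
ConjugateBounds true  μ c = φ⁻¹ ≼ c × c ≼ φ̂ -φ μ
ConjugateBounds false μ c = μ -φ 1φ ≼ c × c ≼ φ⁻¹ -φ μ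

conjugateBounds-weaken : ∀ b {μ c} → μ ≼ 1φ → ConjugateBounds b μ c → μ -φ 1φ ≼ c × c ≼ φ̂ -φ μ
conjugateBounds-weaken true {μ} {c} μ≤1 (φ⁻¹≤c , c≤φ-μ) = μ-1≤c , c≤φ-μ
  where
  open ≼-Reasoning
  μ-1≤c : μ -φ 1φ ≼ c
  μ-1≤c = begin
    μ -φ 1φ   ≤⟨ +φ-monoˡ-≼ (-φ 1φ) μ≤1 ⟩
    1φ -φ 1φ  ≤⟨ from-yes (1φ -φ 1φ ≼? φ⁻¹) ⟩
    φ⁻¹       ≤⟨ φ⁻¹≤c ⟩
    c         ∎
conjugateBounds-weaken false {μ} μ≤1 (μ-1≤c , c≤φ⁻¹-μ) =
  μ-1≤c , ≼-trans c≤φ⁻¹-μ (+φ-monoˡ-≼ (-φ μ) (from-yes (φ⁻¹ ≼? φ̂)))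

conjugateBounds-step : ∀ b₁ b₂ {μ c} → 0φ ≼ μ → μ ≼ 1φ → b₁ ∧ b₂ ≡ false →
  ConjugateBounds b₁ μ c → ConjugateBounds b₂ (μ *φ φ⁻¹) (ofℕ (bit b₂) +φ ψ̂ *φ c)
conjugateBounds-step b₁ false {μ} {c} _ μ≤1 _ bounds = lower , upper
  where
  open ≼-Reasoning
  weakened = conjugateBounds-weaken b₁ μ≤1 bounds
  identityₗ : ∀ μ → μ *φ φ⁻¹ -φ 1φ ≡ 0φ +φ ψ̂ *φ (φ̂ -φ μ)
  identityₗ = solve-∀ Qφ-ring
  identityᵤ : ∀ μ → 0φ +φ ψ̂ *φ (μ -φ 1φ) ≡ φ⁻¹ -φ μ *φ φ⁻¹
  identityᵤ = solve-∀ Qφ-ring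
  lower : μ *φ φ⁻¹ -φ 1φ ≼ 0φ +φ ψ̂ *φ c
  lower = begin
    μ *φ φ⁻¹ -φ 1φ        ≡⟨ identityₗ μ ⟩
    0φ +φ ψ̂ *φ (φ̂ -φ μ)   ≤⟨ +φ-monoʳ-≼ 0φ (*φ-antimonoˡ-≼-ψ (proj₂ weakened)) ⟩
    0φ +φ ψ̂ *φ c          ∎
  upper : 0φ +φ ψ̂ *φ c ≼ φ⁻¹ -φ μ *φ φ⁻¹
  upper = begin
    0φ +φ ψ̂ *φ c          ≤⟨ +φ-monoʳ-≼ 0φ (*φ-antimonoˡ-≼-ψ (proj₁ weakened)) ⟩
    0φ +φ ψ̂ *φ (μ -φ 1φ)  ≡⟨ identityᵤ μ ⟩
    φ⁻¹ -φ μ *φ φ⁻¹       ∎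
conjugateBounds-step false true {μ} {c} 0≤μ _ _ (μ-1≤c , c≤φ⁻¹-μ) = lower , upper
  where
  open ≼-Reasoning
  identityₗ : ∀ μ → φ⁻¹ +φ μ *φ φ⁻¹ ≡ 1φ +φ ψ̂ *φ (φ⁻¹ -φ μ)
  identityₗ = solve-∀ Qφ-ring
  identityᵤ : ∀ μ → 1φ +φ ψ̂ *φ (μ -φ 1φ) ≡ φ̂ -φ μ *φ φ⁻¹
  identityᵤ = solve-∀ Qφ-ring
  lower : φ⁻¹ ≼ 1φ +φ ψ̂ *φ c
  lower = begin
    φ⁻¹                    ≤⟨ x≼x+φy (*φ-monoʳ-≼-φ⁻¹ 0≤μ) ⟩
    φ⁻¹ +φ μ *φ φ⁻¹        ≡⟨ identityₗ μ ⟩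
    1φ +φ ψ̂ *φ (φ⁻¹ -φ μ)  ≤⟨ +φ-monoʳ-≼ 1φ (*φ-antimonoˡ-≼-ψ c≤φ⁻¹-μ) ⟩
    1φ +φ ψ̂ *φ c           ∎
  upper : 1φ +φ ψ̂ *φ c ≼ φ̂ -φ μ *φ φ⁻¹
  upper = begin
    1φ +φ ψ̂ *φ c           ≤⟨ +φ-monoʳ-≼ 1φ (*φ-antimonoˡ-≼-ψ μ-1≤c) ⟩
    1φ +φ ψ̂ *φ (μ -φ 1φ)   ≡⟨ identityᵤ μ ⟩
    φ̂ -φ μ *φ φ⁻¹          ∎

conjugateBounds : ∀ {d} → NoConsecutiveOnes d →
  ∀ k → ConjugateBounds (lastDigit d k) (φ^- (suc k)) (digitsψ d k)
conjugateBounds {d} no11 zero    =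
  from-yes (φ^- 1 -φ 1φ ≼? digitsψ d 0) , from-yes (digitsψ d 0 ≼? φ⁻¹ -φ φ^- 1)
conjugateBounds {d} no11 (suc k) =
  subst (ConjugateBounds (d (suc k)) (φ^- (suc (suc k)))) (sym (digitsψ-suc d k))
    (conjugateBounds-step (lastDigit d k) (d (suc k)) (0≼φ^- (suc k)) (φ^-≼1 (suc k)) (lastDigit-∧ no11 k)
      (conjugateBounds no11 k))

-- The φ-coefficient is a Fibonacci sum

module _ where
  open ≡-Reasoning

  sum1-cong : ∀ {f g} n → (∀ i → f (suc i) ≡ g (suc i)) → sum1 f n ≡ sum1 g n
  sum1-cong zero    f≗g = refl
  sum1-cong (suc n) f≗g = cong₂ ℕ._+_ (sum1-cong n f≗g) (f≗g n)

  sum1-+ : ∀ f g n → sum1 (λ i → f i ℕ.+ g i) n ≡ sum1 f n ℕ.+ sum1 g n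
  sum1-+ f g zero    = refl
  sum1-+ f g (suc n) = begin
    sum1 (λ i → f i ℕ.+ g i) n ℕ.+ (f (suc n) ℕ.+ g (suc n))
      ≡⟨ cong (ℕ._+ (f (suc n) ℕ.+ g (suc n))) (sum1-+ f g n) ⟩
    (sum1 f n ℕ.+ sum1 g n) ℕ.+ (f (suc n) ℕ.+ g (suc n))
      ≡⟨ interchange (sum1 f n) (sum1 g n) (f (suc n)) (g (suc n)) ⟩
    sum1 f (suc n) ℕ.+ sum1 g (suc n)
      ∎
    where interchange : ∀ a b c d → (a ℕ.+ b) ℕ.+ (c ℕ.+ d) ≡ (a ℕ.+ c) ℕ.+ (b ℕ.+ d)
          interchange = solve-∀ℕ

  sum1-peel : ∀ f n → sum1 f (suc n) ≡ f 1 ℕ.+ sum1 (λ i → f (suc i)) n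
  sum1-peel f zero    = ℕ.+-comm 0 (f 1)
  sum1-peel f (suc n) = trans (cong (ℕ._+ f (suc (suc n))) (sum1-peel f n)) (ℕ.+-assoc (f 1) _ _)

fibConvolution : (ℕ → ℕ) → ℕ → ℕ
fibConvolution f n = sum1 (λ i → f (suc n ∸ i) ℕ.* fib i) n

fibConvolution-suc-suc : ∀ f n →
  fibConvolution f (suc (suc n)) ≡ f (suc (suc n)) ℕ.+ (fibConvolution f (suc n) ℕ.+ fibConvolution f n)
fibConvolution-suc-suc f n = begin
  fibConvolution f (suc (suc n))
    ≡⟨ sum1-peel term (suc n) ⟩
  term 1 ℕ.+ sum1 (λ i → term (suc i)) (suc n)
    ≡⟨ cong (term 1 ℕ.+_) (sum1-cong (suc n) λ i → ℕ.*-distribˡ-+ (f (suc n ∸ i)) (fib (suc i)) (fib i)) ⟩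
  term 1 ℕ.+ sum1 (λ i → term′ i ℕ.+ term″ i) (suc n)
    ≡⟨ cong (term 1 ℕ.+_) (sum1-+ term′ term″ (suc n)) ⟩
  term 1 ℕ.+ (fibConvolution f (suc n) ℕ.+ sum1 term″ (suc n))
    ≡⟨ cong (λ s → term 1 ℕ.+ (fibConvolution f (suc n) ℕ.+ s)) (sum1-peel term″ n) ⟩
  term 1 ℕ.+ (fibConvolution f (suc n) ℕ.+ (term″ 1 ℕ.+ fibConvolution f n))
    ≡⟨ cong₂ (λ a b → a ℕ.+ (fibConvolution f (suc n) ℕ.+ (b ℕ.+ fibConvolution f n)))
             (ℕ.*-identityʳ (f (suc (suc n)))) (ℕ.*-zeroʳ (f (suc n))) ⟩
  f (suc (suc n)) ℕ.+ (fibConvolution f (suc n) ℕ.+ fibConvolution f n)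
    ∎
  where
  open ≡-Reasoning
  term term′ term″ : ℕ → ℕ
  term i  = f (suc (suc (suc n)) ∸ i) ℕ.* fib i
  term′ i = f (suc (suc n) ∸ i) ℕ.* fib i
  term″ i = f (suc (suc n) ∸ i) ℕ.* fib (ℕ.pred i)

φCoeff≡fibConvolution : ∀ d n → φCoeff d (suc n) ≡ fibConvolution (bit ∘ d) n
φCoeff≡fibConvolution d n = proj₁ (two-steps n)
  where
  open ≡-Reasoning
  rotate : ∀ a b c → (a ℕ.+ b) ℕ.+ c ≡ b ℕ.+ (c ℕ.+ a)
  rotate = solve-∀ℕ
  two-steps : ∀ n → φCoeff d (suc n) ≡ fibConvolution (bit ∘ d) n
                  × φCoeff d (suc (suc n)) ≡ fibConvolution (bit ∘ d) (suc n)
  two-steps zero    = refl , trans (ℕ.+-identityʳ (bit (d 1))) (sym (ℕ.*-identityʳ (bit (d 1))))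
  two-steps (suc n) with two-steps n
  ... | eq₁ , eq₂ = eq₂ , (begin
    (φCoeff d (suc n) ℕ.+ bit (d (suc (suc n)))) ℕ.+ φCoeff d (suc (suc n))
      ≡⟨ cong₂ (λ a b → (a ℕ.+ bit (d (suc (suc n)))) ℕ.+ b) eq₁ eq₂ ⟩
    (fibConvolution (bit ∘ d) n ℕ.+ bit (d (suc (suc n)))) ℕ.+ fibConvolution (bit ∘ d) (suc n)
      ≡⟨ rotate (fibConvolution (bit ∘ d) n) (bit (d (suc (suc n)))) (fibConvolution (bit ∘ d) (suc n)) ⟩
    bit (d (suc (suc n))) ℕ.+ (fibConvolution (bit ∘ d) (suc n) ℕ.+ fibConvolution (bit ∘ d) n)
      ≡⟨ fibConvolution-suc-suc (bit ∘ d) n ⟨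
    fibConvolution (bit ∘ d) (suc (suc n))
      ∎)

reversed-noConsecutive : ∀ {d} → NoConsecutiveOnes d →
  ∀ L i → 1 ℕ.≤ i → suc i ℕ.≤ L → d (suc L ∸ i) ∧ d (L ∸ i) ≡ false
reversed-noConsecutive {d} no11 L i _ i<L = begin
  d (suc L ∸ i) ∧ d (L ∸ i)    ≡⟨ cong (λ j → d j ∧ d (L ∸ i)) (ℕ.+-∸-assoc 1 (ℕ.<⇒≤ i<L)) ⟩
  d (suc (L ∸ i)) ∧ d (L ∸ i)  ≡⟨ Bool.∧-comm (d (suc (L ∸ i))) (d (L ∸ i)) ⟩
  d (L ∸ i) ∧ d (suc (L ∸ i))  ≡⟨ no11 (L ∸ i) (ℕ.m<n⇒0<n∸m i<L) ⟩
  false                        ∎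
  where open ≡-Reasoning

ofℕ-sub-*√5-≼ : ∀ {m n} → m ℕ.< n → (ofℕ m -φ ofℕ n) *φ √5 ≼ -φ √5
ofℕ-sub-*√5-≼ {m} {n} m<n with ℕ.m≤n⇒∃[o]m+o≡n m<n
... | k , refl = begin
  (ofℕ m -φ ofℕ (suc m ℕ.+ k)) *φ √5
    ≡⟨ cong (λ v → (ofℕ m -φ v) *φ √5) (trans (ofℕ-+ (suc m) k) (cong (_+φ ofℕ k) (ofℕ-+ 1 m))) ⟩
  (ofℕ m -φ ((1φ +φ ofℕ m) +φ ofℕ k)) *φ √5
    ≡⟨ identity (ofℕ m) (ofℕ k) ⟩
  -φ √5 +φ -φ (ofℕ k *φ √5)
    ≤⟨ +φ-monoʳ-≼ (-φ √5) (-φ-antimono-≼ (*φ-monoʳ-≼-√5 (0≼ofℕ k))) ⟩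
  -φ √5
    ∎
  where
  open ≼-Reasoning
  identity : ∀ a k → (a -φ ((1φ +φ a) +φ k)) *φ √5 ≡ -φ √5 +φ -φ (k *φ √5)
  identity = solve-∀ Qφ-ring

ofℕ-sub-*√5-≽ : ∀ {m n} → n ℕ.< m → √5 ≼ (ofℕ m -φ ofℕ n) *φ √5
ofℕ-sub-*√5-≽ {m} {n} n<m with ℕ.m≤n⇒∃[o]m+o≡n n<m
... | k , refl = begin
  √5
    ≤⟨ x≼x+φy (*φ-monoʳ-≼-√5 (0≼ofℕ k)) ⟩
  √5 +φ ofℕ k *φ √5
    ≡⟨ identity (ofℕ n) (ofℕ k) ⟩
  (((1φ +φ ofℕ n) +φ ofℕ k) -φ ofℕ n) *φ √5
    ≡⟨ cong (λ v → (v -φ ofℕ n) *φ √5) (trans (ofℕ-+ (suc n) k) (cong (_+φ ofℕ k) (ofℕ-+ 1 n))) ⟨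
  (ofℕ (suc n ℕ.+ k) -φ ofℕ n) *φ √5
    ∎
  where
  open ≼-Reasoning
  identity : ∀ a k → √5 +φ k *φ √5 ≡ (((1φ +φ a) +φ k) -φ a) *φ √5
  identity = solve-∀ Qφ-ring

tailBound-*φ^ : ∀ b k → tailBound b k *φ φ^ k ≡ (if b then φ⁻¹ else 1φ)
tailBound-*φ^ true  k = trans (regroup (φ^- k) (φ^ k)) (cong (_*φ φ⁻¹) (φ^-*φ^ k))
  where regroup : ∀ a p → (a *φ φ⁻¹) *φ p ≡ (a *φ p) *φ φ⁻¹
        regroup = solve-∀ Qφ-ring
tailBound-*φ^ false k = φ^-*φ^ k

digitsφ≼x*φ^ : ∀ {d x} → IsExpansion d x → ∀ m → digitsφ d m ≼ x *φ φ^ m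
digitsφ≼x*φ^ {d} {x} (below , _) m =
  subst (_≼ x *φ φ^ m) (partialφ-*φ^ d m) (*φ-monoʳ-≼-φ^ m (≤φ⇒≼ {partialφ d m} {x} (below m)))

x*φ^≼digitsφ+ : ∀ {d x} → NoConsecutiveOnes d → IsExpansion d x → ∀ m →
  x *φ φ^ m ≼ digitsφ d m +φ (if lastDigit d m then φ⁻¹ else 1φ)
x*φ^≼digitsφ+ {d} {x} no11 expansion m = begin
  x *φ φ^ m                                      ≤⟨ *φ-monoʳ-≼-φ^ m x≤S⁺ ⟩
  (partialφ d m +φ tailBound b m) *φ φ^ m        ≡⟨ distrib (partialφ d m) (tailBound b m) (φ^ m) ⟩
  partialφ d m *φ φ^ m +φ tailBound b m *φ φ^ m  ≡⟨ cong₂ _+φ_ (partialφ-*φ^ d m) (tailBound-*φ^ b m) ⟩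
  digitsφ d m +φ (if b then φ⁻¹ else 1φ)         ∎
  where
  open ≼-Reasoning
  b = lastDigit d m
  x≤S⁺ = expansion≼partialφ⁺ {d} {x} no11 expansion m
  distrib : ∀ s t p → (s +φ t) *φ p ≡ s *φ p +φ t *φ p
  distrib = solve-∀ Qφ-ring

conjugate-sum-bounds : ∀ b {μ g c} → μ ≼ 1φ → 0φ ≼ g → g ≼ (if b then φ⁻¹ else 1φ) →
  ConjugateBounds b μ c → μ -φ 1φ ≼ g +φ c × g +φ c ≼ √5 -φ μ
conjugate-sum-bounds b {μ} {g} {c} μ≤1 0≤g g≤t bounds = lower , upper b g≤t bounds
  where
  open ≼-Reasoning
  zero-+ : ∀ x → 0φ +φ x ≡ x
  zero-+ = solve-∀ Qφ-ring
  lower : μ -φ 1φ ≼ g +φ c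
  lower = subst (_≼ g +φ c) (zero-+ (μ -φ 1φ))
            (+φ-mono-≼ 0≤g (proj₁ (conjugateBounds-weaken b μ≤1 bounds)))
  upper : ∀ b → g ≼ (if b then φ⁻¹ else 1φ) → ConjugateBounds b μ c → g +φ c ≼ √5 -φ μ
  upper true g≤φ⁻¹ (_ , c≤φ-μ) = begin
    g +φ c            ≤⟨ +φ-mono-≼ g≤φ⁻¹ c≤φ-μ ⟩
    φ⁻¹ +φ (φ̂ -φ μ)   ≡⟨ identity μ ⟩
    √5 -φ μ           ∎
    where identity : ∀ μ → φ⁻¹ +φ (φ̂ -φ μ) ≡ √5 -φ μ
          identity = solve-∀ Qφ-ring
  upper false g≤1 (_ , c≤φ⁻¹-μ) = begin
    g +φ c            ≤⟨ +φ-mono-≼ g≤1 c≤φ⁻¹-μ ⟩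
    1φ +φ (φ⁻¹ -φ μ)  ≡⟨ identity μ ⟩
    φ̂ -φ μ            ≤⟨ +φ-monoˡ-≼ (-φ μ) (from-yes (φ̂ ≼? √5)) ⟩
    √5 -φ μ           ∎
    where identity : ∀ μ → 1φ +φ (φ⁻¹ -φ μ) ≡ φ̂ -φ μ
          identity = solve-∀ Qφ-ring

conjugate-sum≡0⇒false : ∀ b {μ g c} → 0φ ≼ g → ConjugateBounds b μ c → g +φ c ≡ 0φ → b ≡ false
conjugate-sum≡0⇒false false _ _ _ = refl
conjugate-sum≡0⇒false true {g = g} {c} 0≤g (φ⁻¹≤c , _) g+c≡0 = ⊥-elim (from-no (φ⁻¹ ≼? 0φ) (begin
  φ⁻¹     ≤⟨ +φ-mono-≼ 0≤g φ⁻¹≤c ⟩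
  g +φ c  ≡⟨ g+c≡0 ⟩
  0φ      ∎))
  where open ≼-Reasoning

√5-multiple-digits : ∀ {d x} N m → NoConsecutiveOnes d → IsExpansion d x → ofℕ N *φ √5 ≡ x *φ φ^ m →
  N ≡ φCoeff d m × lastDigit d m ≡ false
√5-multiple-digits {d} {x} N m no11 expansion N√5≡xφ^m = compare (ℕ.<-cmp N B)
  where
  open ≼-Reasoning
  B = φCoeff d m
  μ = φ^- (suc m)
  g = x *φ φ^ m -φ digitsφ d m
  C = digitsψ d m

  g+C≡ : g +φ C ≡ (ofℕ N -φ ofℕ B) *φ √5
  g+C≡ = begin-equality
    (x *φ φ^ m -φ digitsφ d m) +φ C    ≡⟨ cong (λ v → (v -φ digitsφ d m) +φ C) N√5≡xφ^m ⟨
    (ofℕ N *φ √5 -φ digitsφ d m) +φ C  ≡⟨ regroup (ofℕ N *φ √5) (digitsφ d m) C ⟩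
    ofℕ N *φ √5 -φ (digitsφ d m -φ C)  ≡⟨ cong (λ v → ofℕ N *φ √5 -φ v) (digitsφ-digitsψ d m) ⟩
    ofℕ N *φ √5 -φ ofℕ B *φ √5         ≡⟨ factor (ofℕ N) (ofℕ B) ⟩
    (ofℕ N -φ ofℕ B) *φ √5             ∎
    where
    regroup : ∀ a G c → (a -φ G) +φ c ≡ a -φ (G -φ c)
    regroup = solve-∀ Qφ-ring
    factor : ∀ a b → a *φ √5 -φ b *φ √5 ≡ (a -φ b) *φ √5
    factor = solve-∀ Qφ-ring

  0≤g : 0φ ≼ g
  0≤g = ≼⇒0≼- (digitsφ≼x*φ^ {d} {x} expansion m)

  bounds : μ -φ 1φ ≼ g +φ C × g +φ C ≼ √5 -φ μ
  bounds = conjugate-sum-bounds (lastDigit d m) {μ} {g} {C} (φ^-≼1 (suc m)) 0≤g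
             (≼+⇒-≼ (x*φ^≼digitsφ+ {d} {x} no11 expansion m)) (conjugateBounds no11 m)

  compare : Tri (N ℕ.< B) (N ≡ B) (B ℕ.< N) → N ≡ B × lastDigit d m ≡ false
  compare (tri< N<B _ _) = ⊥-elim (φ^-≰0 (suc m) (begin
    μ                               ≡⟨ identity μ ⟩
    1φ +φ (μ -φ 1φ)                 ≤⟨ +φ-monoʳ-≼ 1φ (proj₁ bounds) ⟩
    1φ +φ (g +φ C)                  ≡⟨ cong (1φ +φ_) g+C≡ ⟩
    1φ +φ (ofℕ N -φ ofℕ B) *φ √5    ≤⟨ +φ-monoʳ-≼ 1φ (ofℕ-sub-*√5-≼ N<B) ⟩
    1φ +φ -φ √5                     ≤⟨ from-yes (1φ +φ -φ √5 ≼? 0φ) ⟩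
    0φ                              ∎))
    where
    identity : ∀ μ → μ ≡ 1φ +φ (μ -φ 1φ)
    identity = solve-∀ Qφ-ring
  compare (tri≈ _ N≡B _) =
    N≡B , conjugate-sum≡0⇒false (lastDigit d m) {μ} {g} {C} 0≤g (conjugateBounds no11 m)
            (trans g+C≡ (trans (cong (λ n → (ofℕ n -φ ofℕ B) *φ √5) N≡B) (cancel (ofℕ B))))
    where
    cancel : ∀ a → (a -φ a) *φ √5 ≡ 0φ
    cancel = solve-∀ Qφ-ring
  compare (tri> _ _ B<N) = ⊥-elim (φ^-≰0 (suc m) (begin
    μ                               ≡⟨ identity₁ μ ⟩
    (μ +φ √5) -φ √5                 ≤⟨ +φ-monoˡ-≼ (-φ √5) (+φ-monoʳ-≼ μ √5≤√5-μ) ⟩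
    (μ +φ (√5 -φ μ)) -φ √5          ≡⟨ identity₂ μ ⟩
    0φ                              ∎))
    where
    √5≤√5-μ : √5 ≼ √5 -φ μ
    √5≤√5-μ = begin
      √5                      ≤⟨ ofℕ-sub-*√5-≽ B<N ⟩
      (ofℕ N -φ ofℕ B) *φ √5  ≡⟨ g+C≡ ⟨
      g +φ C                  ≤⟨ proj₂ bounds ⟩
      √5 -φ μ                 ∎
    identity₁ : ∀ μ → μ ≡ (μ +φ √5) -φ √5
    identity₁ = solve-∀ Qφ-ring
    identity₂ : ∀ μ → (μ +φ (√5 -φ μ)) -φ √5 ≡ 0φ
    identity₂ = solve-∀ Qφ-ring

open import Data.Nat using (_≤_)

lemma3p2 : (N : ℕ) → 1 ≤ N → (m : ℕ) → 2 ≤ m → (x : Qφ) → In𝓕 x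
    → ofℕ N *φ √5 ≡ x *φ φ^ m
    → (δ : ℕ → Bool) → In𝔇 δ → IsExpansion δ x
    → IsZeckendorfRep N (m ∸ 1) (λ i → δ (m ∸ i)) × δ m ≡ false
lemma3p2 N _ (suc L) (s≤s _) x _ N√5≡xφ^m δ (no11 , _) expansion
  with √5-multiple-digits {δ} {x} N (suc L) no11 expansion N√5≡xφ^m
... | N≡φCoeff , δm≡false =
  (trans N≡φCoeff (φCoeff≡fibConvolution δ L) , reversed-noConsecutive {δ} no11 L) , δm≡false
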